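{- Let $m\ge 3$ be odd, let $s\ge2$ be even but not divisible by $4$, and let $n=sm$. Let $$\eta_1=(t,t,\dots,t)r,\qquad \eta_2=(\delta_1,\dots,\delta_n)z\ \text{ with } \delta_{2i+1}=\delta_{2i+2}=tc^{i}\ (0\le i<n/2),\qquad H=\langle\eta_1,\eta_2\rangle.$$ Then $\Gamma=C_n[mK_1]$ is the skeleton of a polytopal orientable reflexible map $\mathcal{M}$ of type $\{n,2m\}$ with $\mathrm{Aut}^+(\mathcal{M})=H$.
   Context: $C_n[mK_1]$ has vertex set $\{1,\dots,n\}\times\{1,\dots,m\}$ with $(i_1,j_1)\sim(i_2,j_2)$ iff $i_1\equiv i_2\pm1\pmod n$ (residues mod $n$ represented by $1,\dots,n$, mod $m$ by $1,\dots,m$). For $\alpha_i\in S_m$ and a permutation $x$ of $\{1,\dots,n\}$, $(\alpha_1,\dots,\alpha_n)x$ is the vertex permutation $(i,j)\mapsto(ix,j\alpha_i)$; permutations act on the right, products composed left to right. $c=(1\,2\,\cdots\,m)$, $t\in S_m$ fixes $1$ and swaps $j\leftrightarrow m-j+2$ ($2\le j\le m$), $r=(1\,2\,\cdots\,n)$, $z$ fixes $1$ and swaps $j\leftrightarrow n-j+2$ ($2\le j\le n$). A map is a connected finite graph (skeleton) embedded in a closed surface with open-disk faces; polytopal: each face boundary is a cycle and each edge lies on two distinct faces. Map automorphisms are skeleton automorphisms extending to homeomorphisms of the surface. Rotary: vertex stabilisers contain cyclic groups transitive on incident edges and face stabilisers contain cyclic groups transitive on the face's vertices; type $\{p,q\}$: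 faces have $p$ edges, skeleton is $q$-valent. Reflexible: a face stabiliser also contains a reflection of the face. $\mathrm{Aut}^+(\mathcal{M})$ is the rotational group generated by the distinguished generators (one-step rotation of a base face, and one-step rotation about a base vertex of that face, chosen so that their product is an involution reversing a base edge). -}

module Defs where

open import Data.Nat using (ℕ; zero; suc; _+_; _*_; _∸_; _<_; _≤_)
open import Data.Nat.DivMod using (_mod_; _/_)
open import Data.Fin using (Fin; toℕ) renaming (_≟_ to _≟F_)
open import Data.Fin.Base using (Fin)
open import Data.Product using (Σ; ∃; _×_; _,_; proj₁; proj₂)
open import Data.Sum using (_⊎_)
open import Data.List using (List; length; filter; cartesianProduct; allFin)
open import Relation.Binary.PropositionalEquality using (_≡_; _≢_)
open import Relation.Nullary using (Dec; ¬_)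
open import Relation.Nullary.Decidable using (_⊎-dec_)
open import Function using (_⇔_)

-- The paper's residues 1..k are represented by Fin k with
-- paper value a  ↔  Fin element a-1.  Permutations are functions acting
-- on the right; (f ⨾ g) means "first f, then g" (left-to-right product).

_⨾_ : {A : Set} → (A → A) → (A → A) → (A → A)
(f ⨾ g) x = g (f x)

iter : {A : Set} → (A → A) → ℕ → A → A
iter f zero    x = x
iter f (suc k) x = f (iter f k x)

addF : ∀ {k} → Fin k → ℕ → Fin k
addF {suc k} x a = (toℕ x + a) mod (suc k)

negF : ∀ {k} → Fin k → Fin k
negF {suc k} x = (suc k ∸ toℕ x) mod (suc k)

cyc : ∀ {m} → Fin m → Fin m
cyc j = addF j 1

-- t fixes 1 and swaps j ↔ m-j+2 ; in 0-based form  j ↦ -j (mod m)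
refl-t : ∀ {m} → Fin m → Fin m
refl-t = negF

-- r = (1 2 ... n) and z (fixes 1, swaps j ↔ n-j+2), same shapes on Fin n
rot-r : ∀ {n} → Fin n → Fin n
rot-r i = addF i 1

refl-z : ∀ {n} → Fin n → Fin n
refl-z = negF

module Lex (n m : ℕ) where

  V : Set
  V = Fin n × Fin m

  Adj : V → V → Set
  Adj (i₁ , _) (i₂ , _) = (i₁ ≡ rot-r i₂) ⊎ (rot-r i₁ ≡ i₂)

  Adj? : ∀ u v → Dec (Adj u v)
  Adj? (i₁ , _) (i₂ , _) = (i₁ ≟F rot-r i₂) ⊎-dec (rot-r i₁ ≟F i₂)

  vertices : List V
  vertices = cartesianProduct (allFin n) (allFin m)

  degree : V → ℕ
  degree u = length (filter (Adj? u) vertices)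

  -- (α₁,…,αₙ)x  :  (i , j) ↦ (i x , j αᵢ)
  wr : (Fin n → Fin m → Fin m) → (Fin n → Fin n) → V → V
  wr α x (i , j) = (x i , α i j)

  η₁ : V → V
  η₁ = wr (λ _ → refl-t) rot-r

  -- η₂ = (δ₁,…,δₙ) z with δ_{2i+1} = δ_{2i+2} = t c^i ; in 0-based
  -- indexing layer ℓ carries  t c^{⌊ℓ/2⌋}
  η₂ : V → V
  η₂ = wr (λ ℓ → refl-t ⨾ iter cyc (toℕ ℓ / 2)) refl-z

  -- H = ⟨η₁ , η₂⟩ (as a set of vertex permutations, up to pointwise
  -- equality; the group is finite, so products of generators suffice)
  data InH : (V → V) → Set where
    H-id  : InH (λ v → v)
    H-η₁  : ∀ {f} → InH f → InH (f ⨾ η₁)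
    H-η₂  : ∀ {f} → InH f → InH (f ⨾ η₂)
    H-ext : ∀ {f g} → InH f → (∀ v → g v ≡ f v) → InH g

  -- Orientable maps with skeleton C_n[mK_1], encoded combinatorially by
  -- a rotation system: ρ u is a cyclic permutation of the neighbours of u
  -- (ρ u v = successor of v in the local cyclic order at u).

  IsRotationSystem : (V → V → V) → Set
  IsRotationSystem ρ =
    (∀ u v → Adj u v → Adj u (ρ u v)) ×
    (∀ u v w → Adj u v → Adj u w → ρ u v ≡ ρ u w → v ≡ w) ×
    (∀ u v w → Adj u v → Adj u w → ∃ λ k → iter (ρ u) k v ≡ w)

  Dart : Set
  Dart = V × V

  IsDart : Dart → Set
  IsDart (u , v) = Adj u v

  rev : Dart → Dart
  rev (u , v) = (v , u)

  tail : Dart → V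
  tail = proj₁

  module _ (ρ : V → V → V) where

    -- face-traversal permutation of darts
    next : Dart → Dart
    next (u , v) = (v , ρ v u)

    SameFace : Dart → Dart → Set
    SameFace d e = ∃ λ k → iter next k d ≡ e

    FaceLength : Dart → ℕ → Set
    FaceLength d p = (0 < p) × (iter next p d ≡ d) ×
                     (∀ q → 0 < q → q < p → iter next q d ≢ d)

    OnFace : Dart → V → Set
    OnFace d w = ∃ λ k → tail (iter next k d) ≡ w

    -- polytopal: face boundaries are cycles, each edge on two distinct faces
    Polytopal : Set
    Polytopal =
      (∀ d → IsDart d → ∀ p → FaceLength d p →
         (3 ≤ p) × (∀ i j → i < j → j < p →
                      tail (iter next i d) ≢ tail (iter next j d))) ×
      (∀ d → IsDart d → ¬ SameFace d (rev d))

    OfType : ℕ → ℕ → Set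
    OfType p q = (∀ d → IsDart d → FaceLength d p) × (∀ u → degree u ≡ q)

    IsPerm : (V → V) → Set
    IsPerm φ = Σ (V → V) λ ψ → (∀ v → ψ (φ v) ≡ v) × (∀ v → φ (ψ v) ≡ v)

    IsGraphAut : (V → V) → Set
    IsGraphAut φ = IsPerm φ × (∀ u v → Adj u v ⇔ Adj (φ u) (φ v))

    -- map automorphisms: graph automorphisms that preserve, resp. reverse,
    -- the rotation system (i.e. extend to orientation-preserving, resp.
    -- orientation-reversing, homeomorphisms of the surface)
    OrientPresAut : (V → V) → Set
    OrientPresAut φ = IsGraphAut φ ×
      (∀ u v → Adj u v → ρ (φ u) (φ v) ≡ φ (ρ u v))

    OrientRevAut : (V → V) → Set
    OrientRevAut φ = IsGraphAut φ ×
      (∀ u v → Adj u v → ρ (φ u) (φ (ρ u v)) ≡ φ v)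

    MapAut : (V → V) → Set
    MapAut φ = OrientPresAut φ ⊎ OrientRevAut φ

    mapD : (V → V) → Dart → Dart
    mapD φ (u , v) = (φ u , φ v)

    -- φ is an automorphism stabilising the face containing d
    -- (an orientation-reversing φ sends face walks to reversed face walks)
    FaceStab : Dart → (V → V) → Set
    FaceStab d φ = (OrientPresAut φ × SameFace d (mapD φ d)) ⊎
                   (OrientRevAut φ × SameFace d (rev (mapD φ d)))

    FaceReflection : Dart → (V → V) → Set
    FaceReflection d φ = OrientRevAut φ × SameFace d (rev (mapD φ d))

    Rotary : Set
    Rotary =
      (∀ u → ∃ λ φ → MapAut φ × (φ u ≡ u) ×
         (∀ v w → Adj u v → Adj u w → ∃ λ k → iter φ k v ≡ w)) ×
      (∀ d → IsDart d → ∃ λ φ → FaceStab d φ ×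
         (∀ x y → OnFace d x → OnFace d y → ∃ λ k → iter φ k x ≡ y))

    Reflexible : Set
    Reflexible = Rotary ×
      (∃ λ d → IsDart d × ∃ λ φ → FaceReflection d φ)

    RotGroupIs : ((V → V) → Set) → Set
    RotGroupIs G = ∀ φ → OrientPresAut φ ⇔ G φ

-- Index the layers of C_n[mK₁] by ℤ/n and the positions in a layer by ℤ/m, and let sign i = ±1
-- according to the parity of i. At (i, j) the rotation ρ sends (i+1, k) to (i−1, 2j−k+sign i) and
-- (i−1, k) to (i+1, 2j−k); since ρ² shifts the neighbours in layer i+1 by −sign i, it is a single
-- 2m-cycle. η₁ and η₂ commute with ρ; for η₂ this uses ⌊(i+1)/2⌋ ≡ ⌊i/2⌋ + (i mod 2) (mod m), which
-- survives the wrap-around from layer n−1 to 0 because 2m ∣ n. η₂ fixes the base vertex (0, 0) and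
-- acts on its neighbours as ρ⁻¹, and η₂η₁ reverses the base dart; as the skeleton is connected, H is
-- transitive on darts, and since an orientation-preserving automorphism is determined by the image of
-- one dart, H = Aut⁺. The face of the base dart is the cycle through (a, 0), a = 0, …, n−1, which η₁
-- rotates and i ↦ −i reflects; it has length n and does not contain the reversed base dart, and these
-- properties are carried to every face by H.

module Submission where

open import Defs

module ModularArithmetic where

  open import Level using (0ℓ)
  open import Data.Nat as ℕ using (ℕ; zero; suc; NonZero; _<_)
  import Data.Nat.Properties as ℕ
  import Data.Nat.Divisibility as ℕ
  open import Data.Integer as ℤ using (ℤ; +_; -_; _+_; _-_; _*_; ∣_∣)
  import Data.Integer.Properties as ℤ
  open import Data.Integer.Divisibility.Signed
    using (_∣_; divides; ∣m∣n⇒∣m+n; ∣m⇒∣-m; ∣n⇒∣m*n; ∣-trans; ∣⇒∣ᵤ; ∣ᵤ⇒∣)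
  import Data.Integer.DivMod as ℤ using (_/ℕ_; n%ℕd<d; a≡a%ℕn+[a/ℕn]*n)
  open import Data.Integer.Tactic.RingSolver using (solve-∀)
  open import Data.Fin as Fin using (Fin; toℕ; fromℕ<)
  import Data.Fin.Properties as Fin
  open import Data.Empty using (⊥-elim)
  open import Relation.Binary using (Setoid)
  import Relation.Binary.Reasoning.Setoid
  open import Relation.Binary.PropositionalEquality

  -- A record rather than the bare divisibility, so that a, b and k can be inferred from a proof.
  infix 4 _≡_mod_
  record _≡_mod_ (a b : ℤ) (k : ℕ) : Set where
    constructor congruent
    field difference-divisible : + k ∣ a - b
  open _≡_mod_ public

  module _ {k : ℕ} where

    private
      by : ∀ {x c d} → x ≡ c - d → + k ∣ x → c ≡ d mod k
      by eq p = congruent (subst (+ k ∣_) eq p)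

    mod-refl : ∀ {a} → a ≡ a mod k
    mod-refl {a} = congruent (divides (+ 0) (ℤ.+-inverseʳ a))

    ≡⇒mod : ∀ {a b} → a ≡ b → a ≡ b mod k
    ≡⇒mod refl = mod-refl

    mod-sym : ∀ {a b} → a ≡ b mod k → b ≡ a mod k
    mod-sym {a} {b} p = by (identity a b) (∣m⇒∣-m (difference-divisible p))
      where identity : ∀ a b → - (a - b) ≡ b - a
            identity = solve-∀

    mod-trans : ∀ {a b c} → a ≡ b mod k → b ≡ c mod k → a ≡ c mod k
    mod-trans {a} {b} {c} p q = by (ℤ.+-minus-telescope a b c) (∣m∣n⇒∣m+n (difference-divisible p) (difference-divisible q))

    +-mod-cong : ∀ {a b c d} → a ≡ b mod k → c ≡ d mod k → a + c ≡ b + d mod k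
    +-mod-cong {a} {b} {c} {d} p q = by (identity a b c d) (∣m∣n⇒∣m+n (difference-divisible p) (difference-divisible q))
      where identity : ∀ a b c d → a - b + (c - d) ≡ a + c - (b + d)
            identity = solve-∀

    neg-mod-cong : ∀ {a b} → a ≡ b mod k → - a ≡ - b mod k
    neg-mod-cong {a} {b} p = by (identity a b) (∣m⇒∣-m (difference-divisible p))
      where identity : ∀ a b → - (a - b) ≡ - a - - b
            identity = solve-∀

    -‿mod-cong : ∀ {a b c d} → a ≡ b mod k → c ≡ d mod k → a - c ≡ b - d mod k
    -‿mod-cong p q = +-mod-cong p (neg-mod-cong q)

    +-mod-congˡ : ∀ c {a b} → a ≡ b mod k → c + a ≡ c + b mod k
    +-mod-congˡ c = +-mod-cong (mod-refl {c})

    +-mod-congʳ : ∀ c {a b} → a ≡ b mod k → a + c ≡ b + c mod k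
    +-mod-congʳ c p = +-mod-cong p (mod-refl {c})

    -‿mod-congʳ : ∀ c {a b} → a ≡ b mod k → a - c ≡ b - c mod k
    -‿mod-congʳ c p = +-mod-cong p (mod-refl { - c})

    *-mod-congˡ : ∀ c {a b} → a ≡ b mod k → c * a ≡ c * b mod k
    *-mod-congˡ c {a} {b} p = by (identity c a b) (∣n⇒∣m*n c (difference-divisible p))
      where identity : ∀ c a b → c * (a - b) ≡ c * a - c * b
            identity = solve-∀

    *-mod-congʳ : ∀ c {a b} → a ≡ b mod k → a * c ≡ b * c mod k
    *-mod-congʳ c {a} {b} p = mod-trans (≡⇒mod (ℤ.*-comm a c)) (mod-trans (*-mod-congˡ c p) (≡⇒mod (ℤ.*-comm c b)))

    +-multiple-mod : ∀ a q → a + q * + k ≡ a mod k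
    +-multiple-mod a q = congruent (divides q (identity a q (+ k)))
      where identity : ∀ a q k → a + q * k - a ≡ q * k
            identity = solve-∀

    modulus-mod : + k ≡ + 0 mod k
    modulus-mod = congruent (divides (+ 1) (identity (+ k)))
      where identity : ∀ k → k - + 0 ≡ + 1 * k
            identity = solve-∀

    remainder-mod : ∀ {r a} q → a ≡ + r + q * + k → + r ≡ a mod k
    remainder-mod q refl = mod-sym (+-multiple-mod _ q)

    nat-mod-injective : ∀ {a b} → a < k → b < k → + a ≡ + b mod k → a ≡ b
    nat-mod-injective {a} {b} a<k b<k p =
      ℤ.+-injective (ℤ.i-j≡0⇒i≡j (+ a) (+ b) (ℤ.∣i∣≡0⇒i≡0 (small-multiple-is-0 (∣⇒∣ᵤ (difference-divisible p)) distance<k)))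
      where
        distance<k : ∣ + a - + b ∣ < k
        distance<k = subst (_< k) (cong ∣_∣ (sym (ℤ.m-n≡m⊖n a b)))
                           (ℕ.≤-<-trans (ℤ.∣m⊝n∣≤m⊔n a b) (ℕ.⊔-pres-<m a<k b<k))
        small-multiple-is-0 : ∀ {d} → k ℕ.∣ d → d < k → d ≡ 0
        small-multiple-is-0 {zero}  _   _   = refl
        small-multiple-is-0 {suc _} k∣d d<k = ⊥-elim (ℕ.<⇒≱ d<k (ℕ.∣⇒≤ k∣d))

  mod-setoid : ℕ → Setoid 0ℓ 0ℓ
  mod-setoid k = record
    { Carrier       = ℤ
    ; _≈_           = _≡_mod k
    ; isEquivalence = record { refl = mod-refl ; sym = mod-sym ; trans = mod-trans }
    }

  module mod-Reasoning (k : ℕ) = Relation.Binary.Reasoning.Setoid (mod-setoid k)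

  mod-divisor : ∀ {d k a b} → d ℕ.∣ k → a ≡ b mod k → a ≡ b mod d
  mod-divisor d∣k (congruent p) = congruent (∣-trans (∣ᵤ⇒∣ d∣k) p)

  toℤ : ∀ {k} → Fin k → ℤ
  toℤ x = + toℕ x

  toℤ-injective : ∀ {k} {x y : Fin k} → toℤ x ≡ toℤ y mod k → x ≡ y
  toℤ-injective {x = x} {y} p = Fin.toℕ-injective (nat-mod-injective (Fin.toℕ<n x) (Fin.toℕ<n y) p)

  fromℤ : ∀ {k} .{{_ : NonZero k}} → ℤ → Fin k
  fromℤ {k} a = fromℕ< (ℤ.n%ℕd<d a k)

  toℤ-fromℤ : ∀ {k} .{{_ : NonZero k}} a → toℤ (fromℤ {k} a) ≡ a mod k
  toℤ-fromℤ {k} a = remainder-mod (a ℤ./ℕ k)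
    (trans (ℤ.a≡a%ℕn+[a/ℕn]*n a k) (cong (λ r → + r + (a ℤ./ℕ k) * + k) (sym (Fin.toℕ-fromℕ< _))))

  toℤ-addF : ∀ {k} (x : Fin k) a → toℤ (addF x a) ≡ toℤ x + + a mod k
  toℤ-addF {suc k} x a = mod-trans (toℤ-fromℤ (+ (toℕ x ℕ.+ a))) (≡⇒mod (ℤ.pos-+ (toℕ x) a))

  toℤ-negF : ∀ {k} (x : Fin k) → toℤ (negF x) ≡ - toℤ x mod k
  toℤ-negF {suc k} x =
    mod-trans (toℤ-fromℤ (+ (suc k ℕ.∸ toℕ x))) (mod-trans (≡⇒mod difference) (+-multiple-mod (- toℤ x) (+ 1)))
    where
      identity : ∀ a k → k - a ≡ - a + + 1 * k
      identity = solve-∀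
      difference : + (suc k ℕ.∸ toℕ x) ≡ - toℤ x + + 1 * + suc k
      difference = trans (sym (ℤ.⊖-≥ (ℕ.<⇒≤ (Fin.toℕ<n x))))
                         (trans (sym (ℤ.[+m]-[+n]≡m⊖n (suc k) (toℕ x))) (identity (toℤ x) (+ suc k)))

  toℤ-iter-shift : ∀ {k} (f : Fin k → Fin k) → (∀ x → toℤ (f x) ≡ toℤ x + + 1 mod k) →
                   ∀ t x → toℤ (iter f t x) ≡ toℤ x + + t mod k
  toℤ-iter-shift f f-shift zero    x = ≡⇒mod (sym (ℤ.+-identityʳ (toℤ x)))
  toℤ-iter-shift f f-shift (suc t) x = mod-trans (f-shift (iter f t x))
    (mod-trans (+-mod-congʳ (+ 1) (toℤ-iter-shift f f-shift t x)) (≡⇒mod (identity (toℤ x) (+ t))))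
    where identity : ∀ a t → a + t + + 1 ≡ a + (+ 1 + t)
          identity = solve-∀

  toℤ-rot-r : ∀ {k} (i : Fin k) → toℤ (rot-r i) ≡ toℤ i + + 1 mod k
  toℤ-rot-r i = toℤ-addF i 1

  rot-r⁻¹ : ∀ {k} → Fin k → Fin k
  rot-r⁻¹ {suc k} i = fromℤ (toℤ i - + 1)

  toℤ-rot-r⁻¹ : ∀ {k} (i : Fin k) → toℤ (rot-r⁻¹ i) ≡ toℤ i - + 1 mod k
  toℤ-rot-r⁻¹ {suc k} i = toℤ-fromℤ (toℤ i - + 1)

  module _ {k : ℕ} where
    open mod-Reasoning k

    rot-r-rot-r⁻¹ : ∀ (i : Fin k) → rot-r (rot-r⁻¹ i) ≡ i
    rot-r-rot-r⁻¹ i = toℤ-injective (begin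
      toℤ (rot-r (rot-r⁻¹ i))  ≈⟨ toℤ-rot-r (rot-r⁻¹ i) ⟩
      toℤ (rot-r⁻¹ i) + + 1    ≈⟨ +-mod-congʳ (+ 1) (toℤ-rot-r⁻¹ i) ⟩
      toℤ i - + 1 + + 1        ≡⟨ identity (toℤ i) ⟩
      toℤ i                    ∎)
      where identity : ∀ a → a - + 1 + + 1 ≡ a
            identity = solve-∀

    rot-r⁻¹-rot-r : ∀ (i : Fin k) → rot-r⁻¹ (rot-r i) ≡ i
    rot-r⁻¹-rot-r i = toℤ-injective (begin
      toℤ (rot-r⁻¹ (rot-r i))  ≈⟨ toℤ-rot-r⁻¹ (rot-r i) ⟩
      toℤ (rot-r i) - + 1      ≈⟨ -‿mod-congʳ (+ 1) (toℤ-rot-r i) ⟩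
      toℤ i + + 1 - + 1        ≡⟨ identity (toℤ i) ⟩
      toℤ i                    ∎)
      where identity : ∀ a → a + + 1 - + 1 ≡ a
            identity = solve-∀

    rot-r-injective : ∀ {i i' : Fin k} → rot-r i ≡ rot-r i' → i ≡ i'
    rot-r-injective {i} {i'} eq = trans (sym (rot-r⁻¹-rot-r i)) (trans (cong rot-r⁻¹ eq) (rot-r⁻¹-rot-r i'))

    negF-involutive : ∀ (i : Fin k) → negF (negF i) ≡ i
    negF-involutive i = toℤ-injective (begin
      toℤ (negF (negF i))  ≈⟨ toℤ-negF (negF i) ⟩
      - toℤ (negF i)       ≈⟨ neg-mod-cong (toℤ-negF i) ⟩
      - - toℤ i            ≡⟨ ℤ.neg-involutive (toℤ i) ⟩
      toℤ i                ∎)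

    negF-rot-r : ∀ (i : Fin k) → negF (rot-r i) ≡ rot-r⁻¹ (negF i)
    negF-rot-r i = toℤ-injective (begin
      toℤ (negF (rot-r i))     ≈⟨ toℤ-negF (rot-r i) ⟩
      - toℤ (rot-r i)          ≈⟨ neg-mod-cong (toℤ-rot-r i) ⟩
      - (toℤ i + + 1)          ≡⟨ identity (toℤ i) ⟩
      - toℤ i - + 1            ≈⟨ -‿mod-congʳ (+ 1) (toℤ-negF i) ⟨
      toℤ (negF i) - + 1       ≈⟨ toℤ-rot-r⁻¹ (negF i) ⟨
      toℤ (rot-r⁻¹ (negF i))   ∎)
      where identity : ∀ a → - (a + + 1) ≡ - a - + 1
            identity = solve-∀

    rot-r-negF : ∀ (i : Fin k) → rot-r (negF i) ≡ negF (rot-r⁻¹ i)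
    rot-r-negF i = trans (cong (λ i' → rot-r (negF i')) (sym (rot-r-rot-r⁻¹ i)))
                         (trans (cong rot-r (negF-rot-r (rot-r⁻¹ i))) (rot-r-rot-r⁻¹ _))

    rot-r²≢id : 2 < k → ∀ (i : Fin k) → rot-r (rot-r i) ≢ i
    rot-r²≢id 2<k i eq = ℕ.1+n≢0 (nat-mod-injective 2<k (ℕ.<-trans (ℕ.s≤s ℕ.z≤n) 2<k) 2≡0)
      where
        identity : ∀ a → a + + 1 + + 1 - a ≡ + 2
        identity = solve-∀
        2≡0 : + 2 ≡ + 0 mod k
        2≡0 = begin
          + 2                              ≡⟨ identity (toℤ i) ⟨
          toℤ i + + 1 + + 1 - toℤ i        ≈⟨ -‿mod-congʳ (toℤ i) (+-mod-congʳ (+ 1) (toℤ-rot-r i)) ⟨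
          toℤ (rot-r i) + + 1 - toℤ i      ≈⟨ -‿mod-congʳ (toℤ i) (toℤ-rot-r (rot-r i)) ⟨
          toℤ (rot-r (rot-r i)) - toℤ i    ≡⟨ cong (λ x → toℤ x - toℤ i) eq ⟩
          toℤ i - toℤ i                    ≡⟨ ℤ.+-inverseʳ (toℤ i) ⟩
          + 0                              ∎

    toℤ-iter-rot-r : ∀ a (i : Fin k) → toℤ (iter rot-r a i) ≡ toℤ i + + a mod k
    toℤ-iter-rot-r a = toℤ-iter-shift rot-r toℤ-rot-r a

  iter-rot-r-toℕ : ∀ {k} (i : Fin (suc k)) → iter rot-r (toℕ i) Fin.zero ≡ i
  iter-rot-r-toℕ i = toℤ-injective (toℤ-iter-rot-r (toℕ i) Fin.zero)

  iter-rot-r-injective : ∀ {k} {a b} → iter rot-r a (Fin.zero {k}) ≡ iter rot-r b Fin.zero → + a ≡ + b mod suc k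
  iter-rot-r-injective {a = a} {b} eq =
    mod-trans (mod-sym (toℤ-iter-rot-r a Fin.zero)) (mod-trans (≡⇒mod (cong toℤ eq)) (toℤ-iter-rot-r b Fin.zero))

  negF-zero : ∀ {k} → negF (Fin.zero {k}) ≡ Fin.zero
  negF-zero = toℤ-injective (toℤ-negF Fin.zero)


module Skeleton where

  open import Level using (Level)
  open import Data.Nat as ℕ using (ℕ; suc; _+_; _*_; _<_)
  import Data.Nat.Properties as ℕ
  open import Data.Fin using (Fin) renaming (_≟_ to _≟F_)
  open import Data.Product using (_,_)
  open import Data.Sum using (_⊎_; inj₁; inj₂)
  open import Data.List using ([]; _∷_; _++_; map; length; filter; allFin; cartesianProduct)
  open import Data.List.Properties using (filter-++; length-++; length-map; length-tabulate; filter-accept; filter-reject; filter-all; filter-none)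
  import Data.List.Relation.Unary.All as All
  import Data.List.Relation.Unary.All.Properties as All
  open import Data.List.Relation.Unary.Any using (here; there)
  open import Data.List.Relation.Unary.AllPairs using (_∷_)
  open import Data.List.Relation.Unary.Unique.Propositional using (Unique)
  open import Data.List.Relation.Unary.Unique.Propositional.Properties using (allFin⁺)
  open import Data.List.Membership.Propositional using (_∈_)
  open import Data.List.Membership.Propositional.Properties using (∈-allFin)
  open import Relation.Nullary using (¬_; Dec; yes; no)
  open import Relation.Unary using (Pred; Decidable)
  open import Relation.Unary.Properties using (_∪?_)
  open import Data.Empty using (⊥-elim)
  open import Function using (_⇔_; mk⇔)
  open import Relation.Binary.PropositionalEquality
  open ModularArithmetic

  module _ {a ℓ₁ ℓ₂ : Level} {A : Set a} {P : Pred A ℓ₁} {Q : Pred A ℓ₂} (P? : Decidable P) (Q? : Decidable Q) where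

    length-filter-∪ : (∀ {x} → P x → ¬ Q x) → ∀ xs →
                      length (filter (P? ∪? Q?) xs) ≡ length (filter P? xs) + length (filter Q? xs)
    length-filter-∪ disjoint []       = refl
    length-filter-∪ disjoint (x ∷ xs) with P? x | Q? x
    ... | yes p | yes q = ⊥-elim (disjoint p q)
    ... | yes _ | no  _ = cong suc (length-filter-∪ disjoint xs)
    ... | no  _ | yes _ = trans (cong suc (length-filter-∪ disjoint xs)) (sym (ℕ.+-suc _ _))
    ... | no  _ | no  _ = length-filter-∪ disjoint xs

  module _ {a ℓ : Level} {A : Set a} {P : Pred A ℓ} (P? : Decidable P) where

    length-filter-++ : ∀ xs ys → length (filter P? (xs ++ ys)) ≡ length (filter P? xs) + length (filter P? ys)
    length-filter-++ xs ys = trans (cong length (filter-++ P? xs ys)) (length-++ (filter P? xs))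

    length-filter-unique : ∀ {w xs} → Unique xs → w ∈ xs → P w → (∀ {x} → P x → x ≡ w) →
                           length (filter P? xs) ≡ 1
    length-filter-unique (w∉xs ∷ _) (here refl) Pw only =
      trans (cong length (filter-accept P? Pw))
            (cong suc (cong length (filter-none P? (All.map (λ w≢x Px → w≢x (sym (only Px))) w∉xs))))
    length-filter-unique (y∉xs ∷ uniq) (there w∈xs) Pw only =
      trans (cong length (filter-reject P? (λ Py → All.lookup y∉xs w∈xs (only Py))))
            (length-filter-unique uniq w∈xs Pw only)

  module _ {n : ℕ} where

    LayerAdj : Fin n → Fin n → Set
    LayerAdj i i' = (i ≡ rot-r i') ⊎ (rot-r i ≡ i')

    LayerAdj-sym : ∀ {i i'} → LayerAdj i i' → LayerAdj i' i
    LayerAdj-sym (inj₁ eq) = inj₂ (sym eq)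
    LayerAdj-sym (inj₂ eq) = inj₁ (sym eq)

    rot-r-LayerAdj : ∀ {i i'} → LayerAdj i i' ⇔ LayerAdj (rot-r i) (rot-r i')
    rot-r-LayerAdj = mk⇔ (λ { (inj₁ eq) → inj₁ (cong rot-r eq) ; (inj₂ eq) → inj₂ (cong rot-r eq) })
                         (λ { (inj₁ eq) → inj₁ (rot-r-injective eq) ; (inj₂ eq) → inj₂ (rot-r-injective eq) })

    negF-LayerAdj : ∀ {i i'} → LayerAdj i i' ⇔ LayerAdj (negF i) (negF i')
    negF-LayerAdj {i} {i'} = mk⇔ reflect (λ a → subst₂ LayerAdj (negF-involutive i) (negF-involutive i') (reflect a))
      where
        reflect : ∀ {i i'} → LayerAdj i i' → LayerAdj (negF i) (negF i')
        reflect {i} {i'} (inj₁ i≡ri') = inj₂ (trans (cong rot-r (trans (cong negF i≡ri') (negF-rot-r i'))) (rot-r-rot-r⁻¹ _))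
        reflect {i} {i'} (inj₂ ri≡i') = inj₁ (sym (trans (cong rot-r (trans (cong negF (sym ri≡i')) (negF-rot-r i))) (rot-r-rot-r⁻¹ _)))

  module _ {n m : ℕ} where
    open Lex n m

    layerAdj? : (i : Fin n) → Decidable (LayerAdj i)
    layerAdj? i = (λ x → i ≟F rot-r x) ∪? (λ x → rot-r i ≟F x)

    row-adjacent : ∀ {i x} j → LayerAdj i x → length (filter (Adj? (i , j)) (map (x ,_) (allFin m))) ≡ m
    row-adjacent {i} {x} j adj =
      trans (cong length (filter-all (Adj? (i , j)) (All.map⁺ {f = x ,_} (All.universal (λ _ → adj) (allFin m)))))
            (trans (length-map (x ,_) (allFin m)) (length-tabulate (λ y → y)))

    row-apart : ∀ {i x} j → ¬ LayerAdj i x → length (filter (Adj? (i , j)) (map (x ,_) (allFin m))) ≡ 0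
    row-apart {i} {x} j ¬adj =
      cong length (filter-none (Adj? (i , j)) (All.map⁺ {f = x ,_} (All.universal (λ _ → ¬adj) (allFin m))))

    length-filter-Adj : ∀ i j xs → length (filter (Adj? (i , j)) (cartesianProduct xs (allFin m))) ≡
                                     length (filter (layerAdj? i) xs) * m
    length-filter-Adj i j []       = refl
    length-filter-Adj i j (x ∷ xs) =
      trans (length-filter-++ (Adj? (i , j)) (map (x ,_) (allFin m)) (cartesianProduct xs (allFin m))) (rows (layerAdj? i x))
      where
        rows : Dec (LayerAdj i x) →
               length (filter (Adj? (i , j)) (map (x ,_) (allFin m))) + length (filter (Adj? (i , j)) (cartesianProduct xs (allFin m)))
               ≡ length (filter (layerAdj? i) (x ∷ xs)) * m
        rows (yes adj) = trans (cong₂ _+_ (row-adjacent j adj) (length-filter-Adj i j xs))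
                               (cong (λ l → length l * m) (sym (filter-accept (layerAdj? i) adj)))
        rows (no ¬adj) = trans (cong₂ _+_ (row-apart j ¬adj) (length-filter-Adj i j xs))
                               (cong (λ l → length l * m) (sym (filter-reject (layerAdj? i) ¬adj)))

    length-filter-layerAdj : 2 < n → ∀ i → length (filter (layerAdj? i) (allFin n)) ≡ 2
    length-filter-layerAdj 2<n i =
      trans (length-filter-∪ (λ x → i ≟F rot-r x) (λ x → rot-r i ≟F x) disjoint (allFin n)) (cong₂ _+_ below above)
      where
        disjoint : ∀ {x} → i ≡ rot-r x → ¬ (rot-r i ≡ x)
        disjoint {x} i≡rx ri≡x = rot-r²≢id 2<n x (trans (cong rot-r (sym i≡rx)) ri≡x)
        below : length (filter (λ x → i ≟F rot-r x) (allFin n)) ≡ 1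
        below = length-filter-unique (λ x → i ≟F rot-r x) (allFin⁺ n) (∈-allFin (rot-r⁻¹ i))
                  (sym (rot-r-rot-r⁻¹ i)) (λ i≡rx → trans (sym (rot-r⁻¹-rot-r _)) (cong rot-r⁻¹ (sym i≡rx)))
        above : length (filter (λ x → rot-r i ≟F x) (allFin n)) ≡ 1
        above = length-filter-unique (λ x → rot-r i ≟F x) (allFin⁺ n) (∈-allFin (rot-r i)) refl sym

    degree≡2m : 2 < n → ∀ u → degree u ≡ 2 * m
    degree≡2m 2<n (i , j) = trans (length-filter-Adj i j (allFin n)) (cong (_* m) (length-filter-layerAdj 2<n i))


module OrientableMaps where

  open import Data.Nat as ℕ using (ℕ; zero; suc; _+_; _*_; _<_; _≤_)
  import Data.Nat.Properties as ℕ
  open import Data.Fin as Fin using (Fin; toℕ)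
  open import Data.Product using (∃; _×_; _,_; proj₁; proj₂)
  open import Data.Sum using (inj₁; inj₂)
  open import Data.Empty using (⊥-elim)
  open import Function using (mk⇔; Equivalence)
  open import Relation.Nullary using (¬_)
  open import Relation.Binary.PropositionalEquality
  open import Relation.Binary.Definitions using (tri<; tri≈; tri>)
  open ModularArithmetic using (iter-rot-r-toℕ)
  open Skeleton using (LayerAdj-sym)

  open Equivalence using (to; from)

  iter-+ : ∀ {A : Set} (f : A → A) a b x → iter f (a + b) x ≡ iter f a (iter f b x)
  iter-+ f zero    b x = refl
  iter-+ f (suc a) b x = cong f (iter-+ f a b x)

  iter-periodic : ∀ {A : Set} (f : A → A) {p x} → iter f p x ≡ x → ∀ a → iter f (a * p) x ≡ x
  iter-periodic f         eq zero    = refl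
  iter-periodic f {p} {x} eq (suc a) = trans (iter-+ f p (a * p) x) (trans (cong (iter f p) (iter-periodic f eq a)) eq)

  iter-suc : ∀ {A : Set} (f : A → A) K x → iter f (suc K) x ≡ iter f K (f x)
  iter-suc f zero    x = refl
  iter-suc f (suc K) x = cong f (iter-suc f K x)

  iter-preserves : ∀ {A : Set} (P : A → Set) (f : A → A) → (∀ {x} → P x → P (f x)) → ∀ K {x} → P x → P (iter f K x)
  iter-preserves P f f-pres zero    px = px
  iter-preserves P f f-pres (suc K) px = f-pres (iter-preserves P f f-pres K px)

  iter-commute : ∀ {A : Set} (P : A → Set) (f g : A → A) → (∀ {x} → P x → P (f x)) →
                 (∀ {x} → P x → g (f x) ≡ f (g x)) → ∀ K {x} → P x → g (iter f K x) ≡ iter f K (g x)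
  iter-commute P f g f-pres commute zero    px = refl
  iter-commute P f g f-pres commute (suc K) px =
    trans (commute (iter-preserves P f f-pres K px)) (cong f (iter-commute P f g f-pres commute K px))

  module _ {n m : ℕ} where
    open Lex n m

    module _ (ρ : V → V → V) where

      mapD-injective : ∀ {f : V → V} → (∀ {x y} → f x ≡ f y → x ≡ y) → ∀ {d e} → mapD ρ f d ≡ mapD ρ f e → d ≡ e
      mapD-injective f-inj {_ , _} {_ , _} eq = cong₂ _,_ (f-inj (cong proj₁ eq)) (f-inj (cong proj₂ eq))

      module OrientPres {f : V → V} (f-aut : OrientPresAut ρ f) where

        inverse : V → V
        inverse = proj₁ (proj₁ (proj₁ f-aut))

        inverseˡ : ∀ v → inverse (f v) ≡ v
        inverseˡ = proj₁ (proj₂ (proj₁ (proj₁ f-aut)))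

        inverseʳ : ∀ v → f (inverse v) ≡ v
        inverseʳ = proj₂ (proj₂ (proj₁ (proj₁ f-aut)))

        injective : ∀ {x y} → f x ≡ f y → x ≡ y
        injective {x} {y} eq = trans (sym (inverseˡ x)) (trans (cong inverse eq) (inverseˡ y))

        preserves-Adj : ∀ {u v} → Adj u v → Adj (f u) (f v)
        preserves-Adj {u} {v} = to (proj₂ (proj₁ f-aut) u v)

        reflects-Adj : ∀ {u v} → Adj (f u) (f v) → Adj u v
        reflects-Adj {u} {v} = from (proj₂ (proj₁ f-aut) u v)

        commutes : ∀ {u v} → Adj u v → ρ (f u) (f v) ≡ f (ρ u v)
        commutes = proj₂ f-aut _ _

      id-orientPres : OrientPresAut ρ (λ v → v)
      id-orientPres = (((λ v → v) , (λ _ → refl) , (λ _ → refl)) , (λ _ _ → mk⇔ (λ a → a) (λ a → a))) , (λ _ _ _ → refl)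

      ⨾-orientPres : ∀ {f g} → OrientPresAut ρ f → OrientPresAut ρ g → OrientPresAut ρ (f ⨾ g)
      ⨾-orientPres {f} {g} f-aut g-aut =
        ( ( G.inverse ⨾ F.inverse
          , (λ v → trans (cong F.inverse (G.inverseˡ (f v))) (F.inverseˡ v))
          , (λ v → trans (cong g (F.inverseʳ (G.inverse v))) (G.inverseʳ v)))
        , (λ u v → mk⇔ (λ a → G.preserves-Adj (F.preserves-Adj a)) (λ a → F.reflects-Adj (G.reflects-Adj a))))
        , (λ u v a → trans (G.commutes (F.preserves-Adj a)) (cong g (F.commutes a)))
        where module F = OrientPres f-aut
              module G = OrientPres g-aut

      ≗-orientPres : ∀ {f g} → OrientPresAut ρ f → (∀ v → g v ≡ f v) → OrientPresAut ρ g
      ≗-orientPres {f} {g} f-aut g≗f =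
        ( ( F.inverse
          , (λ v → trans (cong F.inverse (g≗f v)) (F.inverseˡ v))
          , (λ v → trans (g≗f (F.inverse v)) (F.inverseʳ v)))
        , (λ u v → mk⇔ (λ a → subst₂ Adj (sym (g≗f u)) (sym (g≗f v)) (F.preserves-Adj a))
                       (λ a → F.reflects-Adj (subst₂ Adj (g≗f u) (g≗f v) a))))
        , (λ u v a → trans (cong₂ ρ (g≗f u) (g≗f v)) (trans (F.commutes a) (sym (g≗f (ρ u v)))))
        where module F = OrientPres f-aut

      inverse-orientPres : ∀ {f} (f-aut : OrientPresAut ρ f) → OrientPresAut ρ (OrientPres.inverse f-aut)
      inverse-orientPres {f} f-aut =
        ( (f , F.inverseʳ , F.inverseˡ)
        , (λ u v → mk⇔ reflect (λ a → subst₂ Adj (F.inverseʳ u) (F.inverseʳ v) (F.preserves-Adj a))))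
        , (λ u v a → F.injective (begin
            f (ρ (F.inverse u) (F.inverse v))          ≡⟨ F.commutes (reflect a) ⟨
            ρ (f (F.inverse u)) (f (F.inverse v))      ≡⟨ cong₂ ρ (F.inverseʳ u) (F.inverseʳ v) ⟩
            ρ u v                                      ≡⟨ F.inverseʳ (ρ u v) ⟨
            f (F.inverse (ρ u v))                      ∎))
        where
          open ≡-Reasoning
          module F = OrientPres f-aut
          reflect : ∀ {u v} → Adj u v → Adj (F.inverse u) (F.inverse v)
          reflect {u} {v} a = F.reflects-Adj (subst₂ Adj (sym (F.inverseʳ u)) (sym (F.inverseʳ v)) a)

      conjugate : ∀ {g} → OrientPresAut ρ g → (V → V) → V → V
      conjugate {g} g-aut φ v = g (φ (OrientPres.inverse g-aut v))

      conjugate-orientPres : ∀ {g φ} (g-aut : OrientPresAut ρ g) → OrientPresAut ρ φ → OrientPresAut ρ (conjugate g-aut φ)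
      conjugate-orientPres g-aut φ-aut = ⨾-orientPres (⨾-orientPres (inverse-orientPres g-aut) φ-aut) g-aut

      wr-isPerm : ∀ {α β : Fin n → Fin m → Fin m} {x y : Fin n → Fin n} →
                  (∀ i → y (x i) ≡ i) → (∀ i → x (y i) ≡ i) →
                  (∀ i j → β (x i) (α i j) ≡ j) → (∀ i j → α (y i) (β i j) ≡ j) → IsPerm ρ (wr α x)
      wr-isPerm {β = β} {y = y} yx xy βα αβ =
        wr β y , (λ (i , j) → cong₂ _,_ (yx i) (βα i j)) , (λ (i , j) → cong₂ _,_ (xy i) (αβ i j))

  module _ {n' m' : ℕ} where
    open Lex (suc n') (suc m')

    module RotationSystem (ρ : V → V → V) (ρ-rot : IsRotationSystem ρ) where

      ρ-preserves-Adj : ∀ {u v} → Adj u v → Adj u (ρ u v)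
      ρ-preserves-Adj = proj₁ ρ-rot _ _

      ρ-injective : ∀ {u v w} → Adj u v → Adj u w → ρ u v ≡ ρ u w → v ≡ w
      ρ-injective = proj₁ (proj₂ ρ-rot) _ _ _

      ρ-cyclic : ∀ {u v w} → Adj u v → Adj u w → ∃ λ K → iter (ρ u) K v ≡ w
      ρ-cyclic = proj₂ (proj₂ ρ-rot) _ _ _

      iter-ρ-Adj : ∀ {u} K {v} → Adj u v → Adj u (iter (ρ u) K v)
      iter-ρ-Adj {u} = iter-preserves (Adj u) (ρ u) ρ-preserves-Adj

      u₀ v₀ : V
      u₀ = Fin.zero , Fin.zero
      v₀ = rot-r Fin.zero , Fin.zero

      u₀~v₀ : Adj u₀ v₀
      u₀~v₀ = inj₂ refl

      dart-induction : (P : V → V → Set) → (∀ {u v} → Adj u v → P u v → P v u) →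
                       (∀ {u w} → Adj u w → P u (ρ u w) → P u w) → P u₀ v₀ → ∀ {u v} → Adj u v → P u v
      dart-induction P reverse back base {u} u~v = let _ , u~w , p = everywhere u in spread u~w u~v p
        where
          around : ∀ {u w} K → Adj u w → P u (iter (ρ u) K w) → P u w
          around zero    u~w p = p
          around (suc K) u~w p = around K u~w (back (iter-ρ-Adj K u~w) p)

          spread : ∀ {u v w} → Adj u v → Adj u w → P u v → P u w
          spread u~v u~w p with ρ-cyclic u~w u~v
          ... | K , eq = around K u~w (subst (P _) (sym eq) p)

          SomeDartAt : V → Set
          SomeDartAt u = ∃ λ v → Adj u v × P u v

          step : ∀ {u w} → SomeDartAt u → Adj u w → SomeDartAt w
          step {u} (v , u~v , p) u~w = u , LayerAdj-sym u~w , reverse u~w (spread u~v u~w p)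

          reach : ∀ a j → SomeDartAt (iter rot-r a Fin.zero , j)
          reach zero    j = step (step {w = v₀} (v₀ , u₀~v₀ , base) u₀~v₀) (inj₁ refl)
          reach (suc a) j = step (reach a Fin.zero) (inj₂ refl)

          everywhere : ∀ u → SomeDartAt u
          everywhere (i , j) = subst (λ i' → SomeDartAt (i' , j)) (iter-rot-r-toℕ i) (reach (toℕ i) j)

      orientPres-unique : ∀ {φ ψ} → OrientPresAut ρ φ → OrientPresAut ρ ψ → φ u₀ ≡ ψ u₀ → φ v₀ ≡ ψ v₀ →
                          ∀ x → φ x ≡ ψ x
      orientPres-unique {φ} {ψ} φ-aut ψ-aut agree₀ agree₁ (i , j) =
        proj₁ (dart-induction Agree (λ _ (p , q) → q , p) back (agree₀ , agree₁) {i , j} {rot-r i , j} (inj₂ refl))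
        where
          module Φ = OrientPres ρ φ-aut
          module Ψ = OrientPres ρ ψ-aut
          open ≡-Reasoning
          Agree : V → V → Set
          Agree u v = φ u ≡ ψ u × φ v ≡ ψ v
          back : ∀ {u w} → Adj u w → Agree u (ρ u w) → Agree u w
          back {u} {w} u~w (p , q) = p , ρ-injective (Φ.preserves-Adj u~w) (subst (λ z → Adj z (ψ w)) (sym p) (Ψ.preserves-Adj u~w))
            (begin
              ρ (φ u) (φ w)  ≡⟨ Φ.commutes u~w ⟩
              φ (ρ u w)      ≡⟨ q ⟩
              ψ (ρ u w)      ≡⟨ Ψ.commutes u~w ⟨
              ρ (ψ u) (ψ w)  ≡⟨ cong (λ z → ρ z (ψ w)) p ⟨
              ρ (φ u) (ψ w)  ∎)

      RotatesAround : V → (V → V) → Set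
      RotatesAround u φ = MapAut ρ φ × φ u ≡ u × (∀ v w → Adj u v → Adj u w → ∃ λ K → iter φ K v ≡ w)

      RotatesFace : Dart → (V → V) → Set
      RotatesFace d φ = FaceStab ρ d φ × (∀ x y → OnFace ρ d x → OnFace ρ d y → ∃ λ K → iter φ K x ≡ y)

      vertex-rotation : ∀ {φ u v} → OrientPresAut ρ φ → φ u ≡ u → Adj u v → ρ u (φ v) ≡ v → RotatesAround u φ
      vertex-rotation {φ} {u} {v} φ-aut φu≡u u~v ρφv≡v =
        inj₁ φ-aut , φu≡u , λ x y u~x u~y → let K , eq = ρ-cyclic u~y u~x in K , trans (cong (iter φ K) (sym eq)) (unwind K u~y)
        where
          module Φ = OrientPres ρ φ-aut
          open ≡-Reasoning
          commute : ∀ {x} → Adj u x → φ (ρ u x) ≡ ρ u (φ x)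
          commute {x} u~x = trans (sym (Φ.commutes u~x)) (cong (λ z → ρ z (φ x)) φu≡u)
          undo : ∀ {x} → Adj u x → φ (ρ u x) ≡ x
          undo {x} u~x = let K , eq = ρ-cyclic u~v u~x in begin
            φ (ρ u x)                         ≡⟨ commute u~x ⟩
            ρ u (φ x)                         ≡⟨ cong (λ z → ρ u (φ z)) eq ⟨
            ρ u (φ (iter (ρ u) K v))          ≡⟨ cong (ρ u) (iter-commute (Adj u) (ρ u) φ ρ-preserves-Adj commute K u~v) ⟩
            ρ u (iter (ρ u) K (φ v))          ≡⟨ iter-suc (ρ u) K (φ v) ⟩
            iter (ρ u) K (ρ u (φ v))          ≡⟨ cong (iter (ρ u) K) ρφv≡v ⟩
            iter (ρ u) K v                    ≡⟨ eq ⟩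
            x                                 ∎
          unwind : ∀ K {y} → Adj u y → iter φ K (iter (ρ u) K y) ≡ y
          unwind zero    u~y = refl
          unwind (suc K) {y} u~y = begin
            iter φ (suc K) (iter (ρ u) (suc K) y)  ≡⟨ iter-suc φ K _ ⟩
            iter φ K (φ (ρ u (iter (ρ u) K y)))    ≡⟨ cong (iter φ K) (undo (iter-ρ-Adj K u~y)) ⟩
            iter φ K (iter (ρ u) K y)              ≡⟨ unwind K u~y ⟩
            y                                      ∎

      next-IsDart : ∀ {d} → IsDart d → IsDart (next ρ d)
      next-IsDart {u , v} u~v = ρ-preserves-Adj (LayerAdj-sym u~v)

      mapD-iter-next : ∀ {f} → OrientPresAut ρ f → ∀ K {d} → IsDart d →
                       mapD ρ f (iter (next ρ) K d) ≡ iter (next ρ) K (mapD ρ f d)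
      mapD-iter-next {f} f-aut = iter-commute IsDart (next ρ) (mapD ρ f) next-IsDart mapD-next
        where
          mapD-next : ∀ {d} → IsDart d → mapD ρ f (next ρ d) ≡ next ρ (mapD ρ f d)
          mapD-next {u , v} u~v = cong (f v ,_) (sym (OrientPres.commutes ρ f-aut (LayerAdj-sym u~v)))

      FaceVerticesDistinct : Dart → ℕ → Set
      FaceVerticesDistinct d p = ∀ i j → i < j → j < p → tail (iter (next ρ) i d) ≢ tail (iter (next ρ) j d)

      FaceLength-unique : ∀ {d p q} → FaceLength ρ d p → FaceLength ρ d q → p ≡ q
      FaceLength-unique {p = p} {q} (0<p , closes-p , minimal-p) (0<q , closes-q , minimal-q) with ℕ.<-cmp p q
      ... | tri< p<q _ _ = ⊥-elim (minimal-q p 0<p p<q closes-p)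
      ... | tri≈ _ p≡q _ = p≡q
      ... | tri> _ _ q<p = ⊥-elim (minimal-p q 0<q q<p closes-q)

      module _ {f} (f-aut : OrientPresAut ρ f) {d} (d-dart : IsDart d) where
        private
          module F = OrientPres ρ f-aut
          transported : ∀ K → iter (next ρ) K (mapD ρ f d) ≡ mapD ρ f (iter (next ρ) K d)
          transported K = sym (mapD-iter-next f-aut K d-dart)

        FaceLength-mapD : ∀ {p} → FaceLength ρ d p → FaceLength ρ (mapD ρ f d) p
        FaceLength-mapD {p} (0<p , closes , minimal) =
          0<p , trans (transported p) (cong (mapD ρ f) closes) ,
          λ q 0<q q<p eq → minimal q 0<q q<p (mapD-injective ρ F.injective (trans (sym (transported q)) eq))

        FaceVerticesDistinct-mapD : ∀ {p} → FaceVerticesDistinct d p → FaceVerticesDistinct (mapD ρ f d) p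
        FaceVerticesDistinct-mapD distinct i j i<j j<p eq =
          distinct i j i<j j<p (F.injective (trans (cong tail (sym (transported i))) (trans eq (cong tail (transported j)))))

        ¬SameFace-rev-mapD : ¬ SameFace ρ d (rev d) → ¬ SameFace ρ (mapD ρ f d) (rev (mapD ρ f d))
        ¬SameFace-rev-mapD ¬same (K , eq) = ¬same (K , mapD-injective ρ F.injective (trans (sym (transported K)) eq))

      face-rotation : ∀ {φ d p} → OrientPresAut ρ φ → IsDart d → FaceLength ρ d p → mapD ρ φ d ≡ next ρ d → RotatesFace d φ
      face-rotation {φ} {d} {suc p} φ-aut d-dart (_ , closes , _) shifts = inj₁ (φ-aut , 1 , sym shifts) , rotates
        where
          open ≡-Reasoning
          arithmetic : ∀ b a p → b + a * p + a ≡ b + a * suc p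
          arithmetic b a p = trans (ℕ.+-assoc b (a * p) a) (cong (b +_) (trans (ℕ.+-comm (a * p) a) (sym (ℕ.*-suc a p))))
          shift : ∀ a → mapD ρ φ (iter (next ρ) a d) ≡ iter (next ρ) (suc a) d
          shift a = trans (mapD-iter-next φ-aut a d-dart) (trans (cong (iter (next ρ) a) shifts) (sym (iter-suc (next ρ) a d)))
          walk : ∀ K a → iter φ K (tail (iter (next ρ) a d)) ≡ tail (iter (next ρ) (K + a) d)
          walk zero    a = refl
          walk (suc K) a = trans (cong φ (walk K a)) (cong tail (shift (K + a)))
          rotates : ∀ x y → OnFace ρ d x → OnFace ρ d y → ∃ λ K → iter φ K x ≡ y
          rotates _ _ (a , refl) (b , refl) = b + a * p , trans (walk (b + a * p) a) (cong tail (begin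
            iter (next ρ) (b + a * p + a) d                ≡⟨ cong (λ K → iter (next ρ) K d) (arithmetic b a p) ⟩
            iter (next ρ) (b + a * suc p) d                ≡⟨ iter-+ (next ρ) b (a * suc p) d ⟩
            iter (next ρ) b (iter (next ρ) (a * suc p) d)  ≡⟨ cong (iter (next ρ) b) (iter-periodic (next ρ) closes a) ⟩
            iter (next ρ) b d                              ∎))

      module _ {g} (g-aut : OrientPresAut ρ g) {φ} (φ-aut : OrientPresAut ρ φ) where
        private
          module 𝒢 = OrientPres ρ g-aut
          conj-aut = conjugate-orientPres ρ g-aut φ-aut

        conjugate-vertex-rotation : ∀ {u v} → φ u ≡ u → Adj u v → ρ u (φ v) ≡ v → RotatesAround (g u) (conjugate ρ g-aut φ)
        conjugate-vertex-rotation {u} {v} φu≡u u~v ρφv≡v =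
          vertex-rotation conj-aut (cong g (trans (cong φ (𝒢.inverseˡ u)) φu≡u)) (𝒢.preserves-Adj u~v) (begin
            ρ (g u) (g (φ (𝒢.inverse (g v))))  ≡⟨ cong (λ z → ρ (g u) (g (φ z))) (𝒢.inverseˡ v) ⟩
            ρ (g u) (g (φ v))                  ≡⟨ 𝒢.commutes u~φv ⟩
            g (ρ u (φ v))                      ≡⟨ cong g ρφv≡v ⟩
            g v                                ∎)
          where
            open ≡-Reasoning
            u~φv : Adj u (φ v)
            u~φv = subst (λ z → Adj z (φ v)) φu≡u (OrientPres.preserves-Adj ρ φ-aut u~v)

        conjugate-face-rotation : ∀ {d p} → IsDart d → FaceLength ρ d p → mapD ρ φ d ≡ next ρ d →
                                  RotatesFace (mapD ρ g d) (conjugate ρ g-aut φ)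
        conjugate-face-rotation {u , v} u~v length shifts =
          face-rotation conj-aut (𝒢.preserves-Adj u~v) (FaceLength-mapD g-aut u~v length)
            (trans (cong₂ (λ x y → g (φ x) , g (φ y)) (𝒢.inverseˡ u) (𝒢.inverseˡ v))
                   (trans (cong (mapD ρ g) shifts) (mapD-iter-next g-aut 1 u~v)))

      d₀ : Dart
      d₀ = u₀ , v₀

      -- Aut⁺ acts freely on darts (orientPres-unique), so a subgroup G containing a reversal of the base dart
      -- and a rotation about its tail, being transitive on darts by dart-induction, is all of Aut⁺.
      module TransitiveSubgroup
        (G : (V → V) → Set)
        (G⊆Aut⁺ : ∀ {f} → G f → OrientPresAut ρ f)
        (G-id : G (λ v → v))
        (G-⨾ : ∀ {f g} → G f → G g → G (f ⨾ g))
        (G-≗ : ∀ {f g} → G f → (∀ v → g v ≡ f v) → G g)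
        {swap spin : V → V}
        (G-swap : G swap) (swap-u₀ : swap u₀ ≡ v₀) (swap-v₀ : swap v₀ ≡ u₀)
        (G-spin : G spin) (spin-u₀ : spin u₀ ≡ u₀) (ρ-spin-v₀ : ρ u₀ (spin v₀) ≡ v₀)
        where

        private
          u₀~spin-v₀ : Adj u₀ (spin v₀)
          u₀~spin-v₀ = subst (λ z → Adj z (spin v₀)) spin-u₀ (OrientPres.preserves-Adj ρ (G⊆Aut⁺ G-spin) u₀~v₀)

          ρ-spin-image : ∀ {g} → G g → ρ (g u₀) (g (spin v₀)) ≡ g v₀
          ρ-spin-image {g} Gg = trans (OrientPres.commutes ρ (G⊆Aut⁺ Gg) u₀~spin-v₀) (cong g ρ-spin-v₀)

        dart-transitive : ∀ {u v} → Adj u v → ∃ λ g → G g × g u₀ ≡ u × g v₀ ≡ v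
        dart-transitive = dart-induction Image reverse back (_ , G-id , refl , refl)
          where
            Image : V → V → Set
            Image u v = ∃ λ g → G g × g u₀ ≡ u × g v₀ ≡ v
            reverse : ∀ {u v} → Adj u v → Image u v → Image v u
            reverse _ (g , Gg , gu₀ , gv₀) =
              swap ⨾ g , G-⨾ G-swap Gg , trans (cong g swap-u₀) gv₀ , trans (cong g swap-v₀) gu₀
            back : ∀ {u w} → Adj u w → Image u (ρ u w) → Image u w
            back {u} {w} u~w (g , Gg , refl , gv₀) =
              spin ⨾ g , G-⨾ G-spin Gg , cong g spin-u₀ ,
              ρ-injective (OrientPres.preserves-Adj ρ (G⊆Aut⁺ Gg) u₀~spin-v₀) u~w (trans (ρ-spin-image Gg) gv₀)

        every-dart : (Q : Dart → Set) → (∀ {g} → G g → Q (mapD ρ g d₀)) → ∀ {d} → IsDart d → Q d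
        every-dart Q base {u , v} u~v = let g , Gg , gu₀ , gv₀ = dart-transitive u~v in subst Q (cong₂ _,_ gu₀ gv₀) (base Gg)

        rotGroupIs : RotGroupIs ρ G
        rotGroupIs φ = mk⇔ (λ φ-aut →
          let g , Gg , gu₀ , gv₀ = dart-transitive (OrientPres.preserves-Adj ρ φ-aut u₀~v₀)
          in G-≗ Gg (orientPres-unique φ-aut (G⊆Aut⁺ Gg) (sym gu₀) (sym gv₀))) G⊆Aut⁺

        module _ {p} (length₀ : FaceLength ρ d₀ p) where

          faceLength : ∀ d → IsDart d → FaceLength ρ d p
          faceLength d = every-dart (λ d → FaceLength ρ d p) (λ Gg → FaceLength-mapD (G⊆Aut⁺ Gg) u₀~v₀ length₀)

          polytopal : 3 ≤ p → FaceVerticesDistinct d₀ p → ¬ SameFace ρ d₀ (rev d₀) → Polytopal ρ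
          polytopal 3≤p distinct₀ ¬rev₀ =
            (λ d d-dart q length → subst (λ q → 3 ≤ q × FaceVerticesDistinct d q)
                                         (FaceLength-unique (faceLength d d-dart) length) (3≤p , distinct d-dart)) ,
            (λ d → every-dart (λ d → ¬ SameFace ρ d (rev d)) (λ Gg → ¬SameFace-rev-mapD (G⊆Aut⁺ Gg) u₀~v₀ ¬rev₀))
            where
              distinct : ∀ {d} → IsDart d → FaceVerticesDistinct d p
              distinct = every-dart (λ d → FaceVerticesDistinct d p) (λ Gg → FaceVerticesDistinct-mapD (G⊆Aut⁺ Gg) u₀~v₀ distinct₀)

          rotary : ∀ {shift} → G shift → mapD ρ shift d₀ ≡ next ρ d₀ → Rotary ρ
          rotary G-shift shift-d₀ =
            (λ (i , j) → let g , Gg , gu₀ , _ = dart-transitive {i , j} {rot-r i , j} (inj₂ refl) in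
               subst (λ u → ∃ (RotatesAround u)) gu₀
                 (_ , conjugate-vertex-rotation (G⊆Aut⁺ Gg) (G⊆Aut⁺ G-spin) spin-u₀ u₀~v₀ ρ-spin-v₀)) ,
            (λ _ → every-dart (λ d → ∃ (RotatesFace d))
               (λ Gg → _ , conjugate-face-rotation (G⊆Aut⁺ Gg) (G⊆Aut⁺ G-shift) u₀~v₀ length₀ shift-d₀))

module Construction where

  open import Data.Nat as ℕ using (ℕ; zero; suc; _<_)
  import Data.Nat.Divisibility as ℕ
  import Data.Nat.Properties as ℕ
  open import Data.Nat.DivMod using (_%_; _/_; m≡m%n+[m/n]*n; m%n<n)
  open import Data.Integer as ℤ using (ℤ; +_; -_; _+_; _-_; _*_)
  import Data.Integer.Properties as ℤ
  open import Data.Integer.Divisibility.Signed using (*-cancelˡ-∣)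
  open import Data.Integer.Tactic.RingSolver using (solve-∀)
  open import Data.Fin as Fin using (Fin; toℕ) renaming (_≟_ to _≟F_)
  open import Data.Product using (∃; _×_; _,_; proj₁; proj₂)
  open import Data.Sum using (_⊎_; inj₁; inj₂)
  open import Data.Empty using (⊥-elim)
  open import Relation.Nullary using (Dec; yes; no; ¬_)
  open import Relation.Binary.PropositionalEquality
  open ModularArithmetic
  open OrientableMaps
  open Skeleton using (rot-r-LayerAdj; negF-LayerAdj; degree≡2m)

  module _ (n' m' : ℕ) (2<n : 2 < suc n') (2m∣n : 2 ℕ.* suc m' ℕ.∣ suc n') where

    n m : ℕ
    n = suc n'
    m = suc m'

    open Lex n m

    parity half : Fin n → ℤ
    parity i = + (toℕ i % 2)
    half   i = + (toℕ i / 2)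

    toℤ-parity-half : ∀ i → toℤ i ≡ parity i + half i * + 2
    toℤ-parity-half i = trans (cong +_ (m≡m%n+[m/n]*n (toℕ i) 2))
                              (trans (ℤ.pos-+ (toℕ i % 2) _) (cong (_+_ (parity i)) (ℤ.pos-* (toℕ i / 2) 2)))

    parity-mod-2 : ∀ i → parity i ≡ toℤ i mod 2
    parity-mod-2 i = remainder-mod (half i) (toℤ-parity-half i)

    parity-bit : ∀ i → parity i ≡ + 0 ⊎ parity i ≡ + 1
    parity-bit i with toℕ i % 2 | m%n<n (toℕ i) 2
    ... | 0 | _ = inj₁ refl
    ... | 1 | _ = inj₂ refl
    ... | suc (suc _) | ℕ.s≤s (ℕ.s≤s ())

    parity-mod-2-injective : ∀ i b → b < 2 → parity i ≡ + b mod 2 → parity i ≡ + b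
    parity-mod-2-injective i b b<2 p = cong +_ (nat-mod-injective (m%n<n (toℕ i) 2) b<2 p)

    mod-n⇒mod-2 : ∀ {a b} → a ≡ b mod n → a ≡ b mod 2
    mod-n⇒mod-2 = mod-divisor (ℕ.∣-trans (ℕ.m∣m*n m) 2m∣n)

    parity-rot-r-mod-2 : ∀ i → parity (rot-r i) ≡ parity i + + 1 mod 2
    parity-rot-r-mod-2 i = begin
      parity (rot-r i)   ≈⟨ parity-mod-2 (rot-r i) ⟩
      toℤ (rot-r i)      ≈⟨ mod-n⇒mod-2 (toℤ-rot-r i) ⟩
      toℤ i + + 1        ≈⟨ +-mod-congʳ (+ 1) (parity-mod-2 i) ⟨
      parity i + + 1     ∎
      where open mod-Reasoning 2

    parity-rot-r : ∀ i → parity (rot-r i) ≡ + 1 - parity i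
    parity-rot-r i with parity-bit i
    ... | inj₁ p≡0 = trans (parity-mod-2-injective (rot-r i) 1 (ℕ.s≤s (ℕ.s≤s ℕ.z≤n))
                              (mod-trans (parity-rot-r-mod-2 i) (≡⇒mod (cong (λ p → p + + 1) p≡0))))
                           (sym (cong (λ p → + 1 - p) p≡0))
    ... | inj₂ p≡1 = trans (parity-mod-2-injective (rot-r i) 0 (ℕ.s≤s ℕ.z≤n)
                              (mod-trans (parity-rot-r-mod-2 i) (mod-trans (≡⇒mod (cong (λ p → p + + 1) p≡1)) (+-multiple-mod (+ 0) (+ 1)))))
                           (sym (cong (λ p → + 1 - p) p≡1))

    parity-negF : ∀ i → parity (negF i) ≡ parity i
    parity-negF i = cong +_ (nat-mod-injective (m%n<n (toℕ (negF i)) 2) (m%n<n (toℕ i) 2) (begin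
      parity (negF i)          ≈⟨ parity-mod-2 (negF i) ⟩
      toℤ (negF i)             ≈⟨ mod-n⇒mod-2 (toℤ-negF i) ⟩
      - toℤ i                  ≈⟨ neg-mod-cong (parity-mod-2 i) ⟨
      - parity i               ≡⟨ identity (parity i) ⟩
      parity i + - parity i * + 2  ≈⟨ +-multiple-mod (parity i) (- parity i) ⟩
      parity i                 ∎))
      where
        open mod-Reasoning 2
        identity : ∀ p → - p ≡ p + - p * + 2
        identity = solve-∀

    -- At i = n − 1 the half drops from n/2 − 1 to 0, so this needs m ∣ n/2.
    half-rot-r : ∀ i → half (rot-r i) ≡ half i + parity i mod m
    half-rot-r i = congruent (*-cancelˡ-∣ (+ 2) (subst₂ _∣_ (ℤ.pos-* 2 m) difference
                     (difference-divisible (mod-divisor 2m∣n (toℤ-rot-r i)))))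
      where
        open import Data.Integer.Divisibility.Signed using (_∣_)
        identity : ∀ p h h' → + 1 - p + h' * + 2 - (p + h * + 2 + + 1) ≡ + 2 * (h' - (h + p))
        identity = solve-∀
        difference : toℤ (rot-r i) - (toℤ i + + 1) ≡ + 2 * (half (rot-r i) - (half i + parity i))
        difference = trans (cong₂ (λ a b → a - (b + + 1))
                                  (trans (toℤ-parity-half (rot-r i)) (cong (λ p → p + half (rot-r i) * + 2) (parity-rot-r i)))
                                  (toℤ-parity-half i))
                           (identity (parity i) (half i) (half (rot-r i)))

    sign : Fin n → ℤ
    sign i = + 2 * parity i - + 1

    sign-rot-r : ∀ i → sign (rot-r i) ≡ - sign i
    sign-rot-r i = trans (cong (λ p → + 2 * p - + 1) (parity-rot-r i)) (identity (parity i))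
      where identity : ∀ p → + 2 * (+ 1 - p) - + 1 ≡ - (+ 2 * p - + 1)
            identity = solve-∀

    sign-negF : ∀ i → sign (negF i) ≡ sign i
    sign-negF i = cong (λ p → + 2 * p - + 1) (parity-negF i)

    sign²≡1 : ∀ i → sign i * sign i ≡ + 1
    sign²≡1 i with parity-bit i
    ... | inj₁ p≡0 = cong (λ p → (+ 2 * p - + 1) * (+ 2 * p - + 1)) p≡0
    ... | inj₂ p≡1 = cong (λ p → (+ 2 * p - + 1) * (+ 2 * p - + 1)) p≡1

    half-rot-r⁻¹ : ∀ i → half i ≡ half (rot-r⁻¹ i) + (+ 1 - parity i) mod m
    half-rot-r⁻¹ i = begin
      half i                                          ≡⟨ cong half (rot-r-rot-r⁻¹ i) ⟨
      half (rot-r (rot-r⁻¹ i))                        ≈⟨ half-rot-r (rot-r⁻¹ i) ⟩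
      half (rot-r⁻¹ i) + parity (rot-r⁻¹ i)           ≡⟨ cong (_+_ (half (rot-r⁻¹ i))) parity-rot-r⁻¹ ⟩
      half (rot-r⁻¹ i) + (+ 1 - parity i)             ∎
      where
        open mod-Reasoning m
        identity : ∀ p → p ≡ + 1 - (+ 1 - p)
        identity = solve-∀
        parity-rot-r⁻¹ : parity (rot-r⁻¹ i) ≡ + 1 - parity i
        parity-rot-r⁻¹ = trans (identity _) (cong (λ p → + 1 - p) (trans (sym (parity-rot-r (rot-r⁻¹ i))) (cong parity (rot-r-rot-r⁻¹ i))))

    reflectAt : Fin m → Fin m → ℤ → Fin m
    reflectAt j k c = fromℤ (+ 2 * toℤ j - toℤ k + c)

    toℤ-reflectAt : ∀ j {k K} c → toℤ k ≡ K mod m → toℤ (reflectAt j k c) ≡ + 2 * toℤ j - K + c mod m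
    toℤ-reflectAt j {k} c k≡K = mod-trans (toℤ-fromℤ _) (+-mod-congʳ c (+-mod-congˡ (+ 2 * toℤ j) (neg-mod-cong k≡K)))

    reflectAt-involutive : ∀ j k c → reflectAt j (reflectAt j k c) c ≡ k
    reflectAt-involutive j k c = toℤ-injective (mod-trans (toℤ-reflectAt j c (toℤ-reflectAt j c mod-refl)) (≡⇒mod (identity (toℤ j) (toℤ k) c)))
      where identity : ∀ j k c → + 2 * j - (+ 2 * j - k + c) + c ≡ k
            identity = solve-∀

    reflectAt-injective : ∀ j {k k'} c → reflectAt j k c ≡ reflectAt j k' c → k ≡ k'
    reflectAt-injective j {k} {k'} c eq = trans (sym (reflectAt-involutive j k c)) (trans (cong (λ x → reflectAt j x c) eq) (reflectAt-involutive j k' c))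

    reflectAt-negF : ∀ j k c → reflectAt (negF j) (negF k) (- c) ≡ negF (reflectAt j k c)
    reflectAt-negF j k c = toℤ-injective (begin
      toℤ (reflectAt (negF j) (negF k) (- c))   ≈⟨ toℤ-reflectAt (negF j) (- c) (toℤ-negF k) ⟩
      + 2 * toℤ (negF j) - - toℤ k + - c        ≈⟨ +-mod-congʳ (- c) (-‿mod-congʳ (- toℤ k) (*-mod-congˡ (+ 2) (toℤ-negF j))) ⟩
      + 2 * - toℤ j - - toℤ k + - c             ≡⟨ identity (toℤ j) (toℤ k) c ⟩
      - (+ 2 * toℤ j - toℤ k + c)               ≈⟨ neg-mod-cong (toℤ-reflectAt j c mod-refl) ⟨
      - toℤ (reflectAt j k c)                   ≈⟨ toℤ-negF (reflectAt j k c) ⟨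
      toℤ (negF (reflectAt j k c))              ∎)
      where
        open mod-Reasoning m
        identity : ∀ j k c → + 2 * - j - - k + - c ≡ - (+ 2 * j - k + c)
        identity = solve-∀

    rotation : (i : Fin n) → Fin m → Fin m → ∀ {i'} → Dec (rot-r i ≡ i') → V
    rotation i j k (yes _) = rot-r⁻¹ i , reflectAt j k (sign i)
    rotation i j k (no _)  = rot-r i , reflectAt j k (+ 0)

    ρ : V → V → V
    ρ (i , j) (i' , k) = rotation i j k (rot-r i ≟F i')

    ρ-forward : ∀ i j k → ρ (i , j) (rot-r i , k) ≡ (rot-r⁻¹ i , reflectAt j k (sign i))
    ρ-forward i j k with rot-r i ≟F rot-r i
    ... | yes _  = refl
    ... | no  ri≢ri = ⊥-elim (ri≢ri refl)

    ρ-backward : ∀ {i} i' j k → i ≡ rot-r i' → ρ (i , j) (i' , k) ≡ (rot-r i , reflectAt j k (+ 0))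
    ρ-backward i' j k refl with rot-r (rot-r i') ≟F i'
    ... | yes rri'≡i' = ⊥-elim (rot-r²≢id 2<n i' rri'≡i')
    ... | no  _       = refl

    rot-r⁻¹≢rot-r : ∀ i → rot-r⁻¹ i ≢ rot-r i
    rot-r⁻¹≢rot-r i eq = rot-r²≢id 2<n i (trans (cong rot-r (sym eq)) (rot-r-rot-r⁻¹ i))

    ρ-preserves-Adj : ∀ u v → Adj u v → Adj u (ρ u v)
    ρ-preserves-Adj (i , j) (_ , k) (inj₂ refl) =
      subst (Adj (i , j)) (sym (ρ-forward i j k)) (inj₁ (sym (rot-r-rot-r⁻¹ i)))
    ρ-preserves-Adj (i , j) (i' , k) (inj₁ i≡ri') =
      subst (Adj (i , j)) (sym (ρ-backward i' j k i≡ri')) (inj₂ refl)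

    ρ-injective : ∀ u v w → Adj u v → Adj u w → ρ u v ≡ ρ u w → v ≡ w
    ρ-injective (i , j) (_ , k) (_ , k') (inj₂ refl) (inj₂ refl) eq =
      cong (rot-r i ,_) (reflectAt-injective j (sign i) (cong proj₂ (trans (sym (ρ-forward i j k)) (trans eq (ρ-forward i j k')))))
    ρ-injective (i , j) (_ , k) (i'' , k') (inj₂ refl) (inj₁ i≡ri'') eq =
      ⊥-elim (rot-r⁻¹≢rot-r i (cong proj₁ (trans (sym (ρ-forward i j k)) (trans eq (ρ-backward i'' j k' i≡ri'')))))
    ρ-injective (i , j) (i' , k) (_ , k') (inj₁ i≡ri') (inj₂ refl) eq =
      ⊥-elim (rot-r⁻¹≢rot-r i (cong proj₁ (trans (sym (ρ-forward i j k')) (trans (sym eq) (ρ-backward i' j k i≡ri')))))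
    ρ-injective (i , j) (i' , k) (i'' , k') (inj₁ i≡ri') (inj₁ i≡ri'') eq =
      cong₂ _,_ (rot-r-injective (trans (sym i≡ri') i≡ri''))
                (reflectAt-injective j (+ 0) (cong proj₂ (trans (sym (ρ-backward i' j k i≡ri')) (trans eq (ρ-backward i'' j k' i≡ri'')))))

    module _ (i : Fin n) (j : Fin m) where
      private
        ρᵤ = ρ (i , j)
        open mod-Reasoning m

      ρ²-forward : ∀ k → ρᵤ (ρᵤ (rot-r i , k)) ≡ (rot-r i , fromℤ (toℤ k - sign i))
      ρ²-forward k = trans (cong ρᵤ (ρ-forward i j k))
        (trans (ρ-backward (rot-r⁻¹ i) j _ (sym (rot-r-rot-r⁻¹ i))) (cong (rot-r i ,_) (toℤ-injective (begin
          toℤ (reflectAt j (reflectAt j k (sign i)) (+ 0))   ≈⟨ toℤ-reflectAt j (+ 0) (toℤ-reflectAt j (sign i) mod-refl) ⟩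
          + 2 * toℤ j - (+ 2 * toℤ j - toℤ k + sign i) + + 0  ≡⟨ identity (toℤ j) (toℤ k) (sign i) ⟩
          toℤ k - sign i                                     ≈⟨ toℤ-fromℤ (toℤ k - sign i) ⟨
          toℤ (fromℤ (toℤ k - sign i))                       ∎))))
        where identity : ∀ j k s → + 2 * j - (+ 2 * j - k + s) + + 0 ≡ k - s
              identity = solve-∀

      forward-orbit : ∀ k t → ∃ λ K → iter ρᵤ K (rot-r i , k) ≡ (rot-r i , fromℤ (toℤ k - + t * sign i))
      forward-orbit k zero = 0 , cong (rot-r i ,_) (toℤ-injective (mod-sym (mod-trans (toℤ-fromℤ _) (≡⇒mod (identity (toℤ k) (sign i))))))
        where identity : ∀ k s → k - + 0 * s ≡ k
              identity = solve-∀
      forward-orbit k (suc t) =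
        let K , eq = forward-orbit k t
        in suc (suc K) , trans (cong (λ x → ρᵤ (ρᵤ x)) eq) (trans (ρ²-forward _) (cong (rot-r i ,_) (toℤ-injective (begin
             toℤ (fromℤ (toℤ (fromℤ (toℤ k - + t * sign i)) - sign i))  ≈⟨ toℤ-fromℤ _ ⟩
             toℤ (fromℤ (toℤ k - + t * sign i)) - sign i                ≈⟨ -‿mod-congʳ (sign i) (toℤ-fromℤ (toℤ k - + t * sign i)) ⟩
             toℤ k - + t * sign i - sign i                              ≡⟨ identity (toℤ k) (+ t) (sign i) ⟩
             toℤ k - (+ 1 + + t) * sign i                               ≈⟨ toℤ-fromℤ _ ⟨
             toℤ (fromℤ (toℤ k - + suc t * sign i))                     ∎))))
        where identity : ∀ k t s → k - t * s - s ≡ k - (+ 1 + t) * s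
              identity = solve-∀

      forward-reachable : ∀ k k' → ∃ λ K → iter ρᵤ K (rot-r i , k) ≡ (rot-r i , k')
      forward-reachable k k' =
        let K , eq = forward-orbit k t
        in K , trans eq (cong (rot-r i ,_) (toℤ-injective (begin
             toℤ (fromℤ (toℤ k - + t * sign i))                         ≈⟨ toℤ-fromℤ _ ⟩
             toℤ k - + t * sign i                                       ≈⟨ +-mod-congˡ (toℤ k) (neg-mod-cong (*-mod-congʳ (sign i) (toℤ-fromℤ (sign i * (toℤ k - toℤ k'))))) ⟩
             toℤ k - sign i * (toℤ k - toℤ k') * sign i                 ≡⟨ identity (toℤ k) (toℤ k') (sign i) ⟩
             toℤ k' + (+ 1 - sign i * sign i) * (toℤ k - toℤ k')        ≡⟨ cong (λ s² → toℤ k' + (+ 1 - s²) * (toℤ k - toℤ k')) (sign²≡1 i) ⟩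
             toℤ k' + + 0 * (toℤ k - toℤ k')                            ≡⟨ ℤ.+-identityʳ (toℤ k') ⟩
             toℤ k'                                                     ∎)))
        where
          t = toℕ (fromℤ {m} (sign i * (toℤ k - toℤ k')))
          identity : ∀ k k' s → k - s * (k - k') * s ≡ k' + (+ 1 - s * s) * (k - k')
          identity = solve-∀

      reachable : ∀ k w → Adj (i , j) w → ∃ λ K → iter ρᵤ K (rot-r i , k) ≡ w
      reachable k (_ , k') (inj₂ refl) = forward-reachable k k'
      reachable k (i' , k') (inj₁ i≡ri') =
        let K , eq = forward-reachable k (reflectAt j k' (sign i))
        in suc K , trans (cong ρᵤ eq) (trans (ρ-forward i j _)
                     (cong₂ _,_ (trans (cong rot-r⁻¹ i≡ri') (rot-r⁻¹-rot-r i')) (reflectAt-involutive j k' (sign i))))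

    ρ-cyclic : ∀ u v w → Adj u v → Adj u w → ∃ λ K → iter (ρ u) K v ≡ w
    ρ-cyclic (i , j) (_ , k) w (inj₂ refl) u~w = reachable i j k w u~w
    ρ-cyclic (i , j) (i' , k) w (inj₁ i≡ri') u~w =
      let K , eq = reachable i j (reflectAt j k (+ 0)) w u~w
      in suc K , trans (iter-suc (ρ (i , j)) K (i' , k)) (trans (cong (iter (ρ (i , j)) K) (ρ-backward i' j k i≡ri')) eq)

    ρ-isRotationSystem : IsRotationSystem ρ
    ρ-isRotationSystem = ρ-preserves-Adj , ρ-injective , ρ-cyclic

    η₁-orientPres : OrientPresAut ρ η₁
    η₁-orientPres =
      ( wr-isPerm ρ {β = λ _ → negF} {y = rot-r⁻¹} rot-r⁻¹-rot-r rot-r-rot-r⁻¹ (λ _ → negF-involutive) (λ _ → negF-involutive)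
      , λ _ _ → rot-r-LayerAdj)
      , commutes
      where
        open ≡-Reasoning
        commutes : ∀ u v → Adj u v → ρ (η₁ u) (η₁ v) ≡ η₁ (ρ u v)
        commutes (i , j) (_ , k) (inj₂ refl) = begin
          ρ (rot-r i , negF j) (rot-r (rot-r i) , negF k)                    ≡⟨ ρ-forward (rot-r i) (negF j) (negF k) ⟩
          rot-r⁻¹ (rot-r i) , reflectAt (negF j) (negF k) (sign (rot-r i))   ≡⟨ cong₂ _,_ (trans (rot-r⁻¹-rot-r i) (sym (rot-r-rot-r⁻¹ i)))
                                                                                   (trans (cong (reflectAt (negF j) (negF k)) (sign-rot-r i)) (reflectAt-negF j k (sign i))) ⟩
          rot-r (rot-r⁻¹ i) , negF (reflectAt j k (sign i))                  ≡⟨ cong η₁ (ρ-forward i j k) ⟨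
          η₁ (ρ (i , j) (rot-r i , k))                                       ∎
        commutes (i , j) (i' , k) (inj₁ i≡ri') = begin
          ρ (rot-r i , negF j) (rot-r i' , negF k)                           ≡⟨ ρ-backward (rot-r i') (negF j) (negF k) (cong rot-r i≡ri') ⟩
          rot-r (rot-r i) , reflectAt (negF j) (negF k) (+ 0)                ≡⟨ cong (rot-r (rot-r i) ,_) (reflectAt-negF j k (+ 0)) ⟩
          rot-r (rot-r i) , negF (reflectAt j k (+ 0))                       ≡⟨ cong η₁ (ρ-backward i' j k i≡ri') ⟨
          η₁ (ρ (i , j) (i' , k))                                            ∎

    σ : V → V
    σ = wr (λ _ j → j) negF

    negF≡rot-r-negF-rot-r : ∀ (i : Fin n) → negF i ≡ rot-r (negF (rot-r i))
    negF≡rot-r-negF-rot-r i = sym (trans (cong rot-r (negF-rot-r i)) (rot-r-rot-r⁻¹ (negF i)))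

    σ-orientRev : OrientRevAut ρ σ
    σ-orientRev =
      ( wr-isPerm ρ {β = λ _ j → j} {y = negF} negF-involutive negF-involutive (λ _ _ → refl) (λ _ _ → refl)
      , λ _ _ → negF-LayerAdj)
      , reverses
      where
        open ≡-Reasoning
        reverses : ∀ u v → Adj u v → ρ (σ u) (σ (ρ u v)) ≡ σ v
        reverses (i , j) (_ , k) (inj₂ refl) = begin
          ρ (negF i , j) (σ (ρ (i , j) (rot-r i , k)))                         ≡⟨ cong (λ v → ρ (negF i , j) (σ v)) (ρ-forward i j k) ⟩
          ρ (negF i , j) (negF (rot-r⁻¹ i) , reflectAt j k (sign i))           ≡⟨ cong (λ i' → ρ (negF i , j) (i' , reflectAt j k (sign i))) (rot-r-negF i) ⟨
          ρ (negF i , j) (rot-r (negF i) , reflectAt j k (sign i))             ≡⟨ ρ-forward (negF i) j _ ⟩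
          rot-r⁻¹ (negF i) , reflectAt j (reflectAt j k (sign i)) (sign (negF i)) ≡⟨ cong₂ _,_ (sym (negF-rot-r i)) (trans (cong (reflectAt j _) (sign-negF i)) (reflectAt-involutive j k (sign i))) ⟩
          negF (rot-r i) , k                                                   ∎
        reverses (i , j) (i' , k) (inj₁ i≡ri') = begin
          ρ (negF i , j) (σ (ρ (i , j) (i' , k)))                              ≡⟨ cong (λ v → ρ (negF i , j) (σ v)) (ρ-backward i' j k i≡ri') ⟩
          ρ (negF i , j) (negF (rot-r i) , reflectAt j k (+ 0))                ≡⟨ ρ-backward (negF (rot-r i)) j (reflectAt j k (+ 0)) (negF≡rot-r-negF-rot-r i) ⟩
          rot-r (negF i) , reflectAt j (reflectAt j k (+ 0)) (+ 0)             ≡⟨ cong₂ _,_ (trans (rot-r-negF i) (cong (λ x → negF (rot-r⁻¹ x)) i≡ri')) (reflectAt-involutive j k (+ 0)) ⟩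
          negF (rot-r⁻¹ (rot-r i')) , k                                        ≡⟨ cong (λ x → negF x , k) (rot-r⁻¹-rot-r i') ⟩
          negF i' , k                                                          ∎

    δ : Fin n → Fin m → Fin m
    δ ℓ = refl-t ⨾ iter cyc (toℕ ℓ / 2)

    toℤ-δ : ∀ i {j J} → toℤ j ≡ J mod m → toℤ (δ i j) ≡ - J + half i mod m
    toℤ-δ i {j} j≡J = mod-trans (toℤ-iter-shift cyc (λ x → toℤ-addF x 1) (toℕ i / 2) (negF j))
                                (+-mod-congʳ (half i) (mod-trans (toℤ-negF j) (neg-mod-cong j≡J)))

    δ⁻¹ : Fin n → Fin m → Fin m
    δ⁻¹ i k = fromℤ (half i - toℤ k)

    δ⁻¹-δ : ∀ i j → δ⁻¹ i (δ i j) ≡ j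
    δ⁻¹-δ i j = toℤ-injective (begin
      toℤ (δ⁻¹ i (δ i j))          ≈⟨ toℤ-fromℤ (half i - toℤ (δ i j)) ⟩
      half i - toℤ (δ i j)         ≈⟨ +-mod-congˡ (half i) (neg-mod-cong (toℤ-δ i {j} mod-refl)) ⟩
      half i - (- toℤ j + half i)  ≡⟨ identity (half i) (toℤ j) ⟩
      toℤ j                        ∎)
      where
        open mod-Reasoning m
        identity : ∀ h j → h - (- j + h) ≡ j
        identity = solve-∀

    δ-δ⁻¹ : ∀ i k → δ i (δ⁻¹ i k) ≡ k
    δ-δ⁻¹ i k = toℤ-injective (begin
      toℤ (δ i (δ⁻¹ i k))          ≈⟨ toℤ-δ i (toℤ-fromℤ (half i - toℤ k)) ⟩
      - (half i - toℤ k) + half i  ≡⟨ identity (half i) (toℤ k) ⟩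
      toℤ k                        ∎)
      where
        open mod-Reasoning m
        identity : ∀ h k → - (h - k) + h ≡ k
        identity = solve-∀

    η₂-forward-coordinate : ∀ i j k → toℤ (reflectAt (δ i j) (δ (rot-r i) k) (+ 0)) ≡
                                       toℤ (δ (rot-r⁻¹ i) (reflectAt j k (sign i))) mod m
    η₂-forward-coordinate i j k = begin
      toℤ (reflectAt (δ i j) (δ (rot-r i) k) (+ 0))
        ≈⟨ toℤ-reflectAt (δ i j) (+ 0) (toℤ-δ (rot-r i) {k} mod-refl) ⟩
      + 2 * toℤ (δ i j) - (- toℤ k + half (rot-r i)) + + 0
        ≈⟨ +-mod-congʳ (+ 0) (-‿mod-cong (*-mod-congˡ (+ 2) (toℤ-δ i {j} mod-refl)) (+-mod-congˡ (- toℤ k) (half-rot-r i))) ⟩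
      + 2 * (- toℤ j + half i) - (- toℤ k + (half i + parity i)) + + 0
        ≡⟨ identity (toℤ j) (toℤ k) (half i) (parity i) ⟩
      - (+ 2 * toℤ j - toℤ k + sign i) + (half i - (+ 1 - parity i))
        ≈⟨ +-mod-congˡ (- (+ 2 * toℤ j - toℤ k + sign i)) (-‿mod-congʳ (+ 1 - parity i) (half-rot-r⁻¹ i)) ⟩
      - (+ 2 * toℤ j - toℤ k + sign i) + (half (rot-r⁻¹ i) + (+ 1 - parity i) - (+ 1 - parity i))
        ≡⟨ cong (_+_ (- (+ 2 * toℤ j - toℤ k + sign i))) (cancel (half (rot-r⁻¹ i)) (+ 1 - parity i)) ⟩
      - (+ 2 * toℤ j - toℤ k + sign i) + half (rot-r⁻¹ i)
        ≈⟨ toℤ-δ (rot-r⁻¹ i) (toℤ-reflectAt j (sign i) mod-refl) ⟨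
      toℤ (δ (rot-r⁻¹ i) (reflectAt j k (sign i)))
        ∎
      where
        open mod-Reasoning m
        identity : ∀ j k h p → + 2 * (- j + h) - (- k + (h + p)) + + 0 ≡ - (+ 2 * j - k + (+ 2 * p - + 1)) + (h - (+ 1 - p))
        identity = solve-∀
        cancel : ∀ h q → h + q - q ≡ h
        cancel = solve-∀

    η₂-backward-coordinate : ∀ i' j k → toℤ (reflectAt (δ (rot-r i') j) (δ i' k) (sign (negF (rot-r i')))) ≡
                                        toℤ (δ (rot-r (rot-r i')) (reflectAt j k (+ 0))) mod m
    η₂-backward-coordinate i' j k = begin
      toℤ (reflectAt (δ (rot-r i') j) (δ i' k) (sign (negF (rot-r i'))))
        ≈⟨ toℤ-reflectAt (δ (rot-r i') j) _ (toℤ-δ i' {k} mod-refl) ⟩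
      + 2 * toℤ (δ (rot-r i') j) - (- toℤ k + half i') + sign (negF (rot-r i'))
        ≡⟨ cong (_+_ (+ 2 * toℤ (δ (rot-r i') j) - (- toℤ k + half i'))) (trans (sign-negF (rot-r i')) (sign-rot-r i')) ⟩
      + 2 * toℤ (δ (rot-r i') j) - (- toℤ k + half i') + - sign i'
        ≈⟨ +-mod-congʳ (- sign i') (-‿mod-congʳ (- toℤ k + half i')
             (*-mod-congˡ (+ 2) (mod-trans (toℤ-δ (rot-r i') {j} mod-refl) (+-mod-congˡ (- toℤ j) (half-rot-r i'))))) ⟩
      + 2 * (- toℤ j + (half i' + parity i')) - (- toℤ k + half i') + - sign i'
        ≡⟨ identity (toℤ j) (toℤ k) (half i') (parity i') ⟩
      - (+ 2 * toℤ j - toℤ k + + 0) + (half i' + parity i' + (+ 1 - parity i'))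
        ≈⟨ +-mod-congˡ (- (+ 2 * toℤ j - toℤ k + + 0)) (mod-sym half-rot-r²) ⟩
      - (+ 2 * toℤ j - toℤ k + + 0) + half (rot-r (rot-r i'))
        ≈⟨ toℤ-δ (rot-r (rot-r i')) (toℤ-reflectAt j (+ 0) mod-refl) ⟨
      toℤ (δ (rot-r (rot-r i')) (reflectAt j k (+ 0)))
        ∎
      where
        open mod-Reasoning m
        identity : ∀ j k h p → + 2 * (- j + (h + p)) - (- k + h) + - (+ 2 * p - + 1) ≡ - (+ 2 * j - k + + 0) + (h + p + (+ 1 - p))
        identity = solve-∀
        half-rot-r² : half (rot-r (rot-r i')) ≡ half i' + parity i' + (+ 1 - parity i') mod m
        half-rot-r² = mod-trans (half-rot-r (rot-r i')) (+-mod-cong (half-rot-r i') (≡⇒mod (parity-rot-r i')))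

    η₂-orientPres : OrientPresAut ρ η₂
    η₂-orientPres =
      ( wr-isPerm ρ {β = λ ℓ → δ⁻¹ (negF ℓ)} {y = negF} negF-involutive negF-involutive
          (λ i j → trans (cong (λ i' → δ⁻¹ i' (δ i j)) (negF-involutive i)) (δ⁻¹-δ i j)) (λ i → δ-δ⁻¹ (negF i))
      , λ _ _ → negF-LayerAdj)
      , commutes
      where
        open ≡-Reasoning
        commutes : ∀ u v → Adj u v → ρ (η₂ u) (η₂ v) ≡ η₂ (ρ u v)
        commutes (i , j) (_ , k) (inj₂ refl) = begin
          ρ (negF i , δ i j) (negF (rot-r i) , δ (rot-r i) k)
            ≡⟨ ρ-backward (negF (rot-r i)) (δ i j) (δ (rot-r i) k) (negF≡rot-r-negF-rot-r i) ⟩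
          rot-r (negF i) , reflectAt (δ i j) (δ (rot-r i) k) (+ 0)
            ≡⟨ cong₂ _,_ (rot-r-negF i) (toℤ-injective (η₂-forward-coordinate i j k)) ⟩
          negF (rot-r⁻¹ i) , δ (rot-r⁻¹ i) (reflectAt j k (sign i))
            ≡⟨ cong η₂ (ρ-forward i j k) ⟨
          η₂ (ρ (i , j) (rot-r i , k))
            ∎
        commutes (_ , j) (i' , k) (inj₁ refl) = begin
          ρ (negF (rot-r i') , δ (rot-r i') j) (negF i' , δ i' k)
            ≡⟨ cong (λ x → ρ (negF (rot-r i') , δ (rot-r i') j) (x , δ i' k)) (negF≡rot-r-negF-rot-r i') ⟩
          ρ (negF (rot-r i') , δ (rot-r i') j) (rot-r (negF (rot-r i')) , δ i' k)
            ≡⟨ ρ-forward (negF (rot-r i')) (δ (rot-r i') j) (δ i' k) ⟩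
          rot-r⁻¹ (negF (rot-r i')) , reflectAt (δ (rot-r i') j) (δ i' k) (sign (negF (rot-r i')))
            ≡⟨ cong₂ _,_ (sym (negF-rot-r (rot-r i'))) (toℤ-injective (η₂-backward-coordinate i' j k)) ⟩
          negF (rot-r (rot-r i')) , δ (rot-r (rot-r i')) (reflectAt j k (+ 0))
            ≡⟨ cong η₂ (ρ-backward i' j k refl) ⟨
          η₂ (ρ (rot-r i' , j) (i' , k))
            ∎

    InH-⨾ : ∀ {f g} → InH f → InH g → InH (f ⨾ g)
    InH-⨾ f∈H H-id            = H-ext f∈H (λ _ → refl)
    InH-⨾ f∈H (H-η₁ g∈H)      = H-η₁ (InH-⨾ f∈H g∈H)
    InH-⨾ f∈H (H-η₂ g∈H)      = H-η₂ (InH-⨾ f∈H g∈H)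
    InH-⨾ {f} f∈H (H-ext g∈H g≗) = H-ext (InH-⨾ f∈H g∈H) (λ v → g≗ (f v))

    InH⊆Aut⁺ : ∀ {f} → InH f → OrientPresAut ρ f
    InH⊆Aut⁺ H-id            = id-orientPres ρ
    InH⊆Aut⁺ (H-η₁ f∈H)      = ⨾-orientPres ρ (InH⊆Aut⁺ f∈H) η₁-orientPres
    InH⊆Aut⁺ (H-η₂ f∈H)      = ⨾-orientPres ρ (InH⊆Aut⁺ f∈H) η₂-orientPres
    InH⊆Aut⁺ (H-ext f∈H g≗f) = ≗-orientPres ρ (InH⊆Aut⁺ f∈H) g≗f

    open RotationSystem ρ ρ-isRotationSystem using (u₀; v₀; u₀~v₀; d₀; FaceVerticesDistinct; module TransitiveSubgroup)

    toℤ-δ-rot-r-zero : toℤ (δ (rot-r Fin.zero) Fin.zero) ≡ + 0 mod m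
    toℤ-δ-rot-r-zero = mod-trans (toℤ-δ (rot-r Fin.zero) {Fin.zero} mod-refl) (half-rot-r Fin.zero)

    zero≡rot-r-negF-rot-r-zero : Fin.zero ≡ rot-r (negF (rot-r (Fin.zero {n'})))
    zero≡rot-r-negF-rot-r-zero = trans (sym negF-zero) (negF≡rot-r-negF-rot-r Fin.zero)

    η₂-u₀ : η₂ u₀ ≡ u₀
    η₂-u₀ = cong₂ _,_ negF-zero negF-zero

    ρ-u₀-η₂-v₀ : ρ u₀ (η₂ v₀) ≡ v₀
    ρ-u₀-η₂-v₀ = trans (ρ-backward (negF (rot-r Fin.zero)) Fin.zero _ zero≡rot-r-negF-rot-r-zero)
      (cong (rot-r Fin.zero ,_) (toℤ-injective (toℤ-reflectAt Fin.zero (+ 0) toℤ-δ-rot-r-zero)))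

    swap-u₀ : (η₂ ⨾ η₁) u₀ ≡ v₀
    swap-u₀ = trans (cong η₁ η₂-u₀) (cong (rot-r Fin.zero ,_) negF-zero)

    swap-v₀ : (η₂ ⨾ η₁) v₀ ≡ u₀
    swap-v₀ = cong₂ _,_ (sym zero≡rot-r-negF-rot-r-zero) (toℤ-injective (mod-trans (toℤ-negF (δ (rot-r Fin.zero) Fin.zero)) (neg-mod-cong toℤ-δ-rot-r-zero)))

    reflectAt-zero : reflectAt Fin.zero Fin.zero (+ 0) ≡ Fin.zero
    reflectAt-zero = toℤ-injective (toℤ-fromℤ (+ 0))

    η₁-shifts-d₀ : mapD ρ η₁ d₀ ≡ next ρ d₀
    η₁-shifts-d₀ = cong₂ _,_ (cong (rot-r Fin.zero ,_) negF-zero)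
      (trans (cong (rot-r (rot-r Fin.zero) ,_) negF-zero)
             (sym (trans (ρ-backward Fin.zero Fin.zero Fin.zero refl) (cong (rot-r (rot-r Fin.zero) ,_) reflectAt-zero))))

    layer : ℕ → V
    layer a = iter rot-r a Fin.zero , Fin.zero

    walk-d₀ : ∀ a → iter (next ρ) a d₀ ≡ (layer a , layer (suc a))
    walk-d₀ zero    = refl
    walk-d₀ (suc a) = trans (cong (next ρ) (walk-d₀ a)) (cong (layer (suc a) ,_)
      (trans (ρ-backward (iter rot-r a Fin.zero) Fin.zero Fin.zero refl) (cong (iter rot-r (suc (suc a)) Fin.zero ,_) reflectAt-zero)))

    layer-injective : ∀ {a b} → a < n → b < n → layer a ≡ layer b → a ≡ b
    layer-injective a<n b<n eq = nat-mod-injective a<n b<n (iter-rot-r-injective (cong proj₁ eq))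

    layer-n : iter rot-r n (Fin.zero {n'}) ≡ Fin.zero
    layer-n = toℤ-injective (mod-trans (toℤ-iter-rot-r n Fin.zero) modulus-mod)

    faceLength-d₀ : FaceLength ρ d₀ n
    faceLength-d₀ = ℕ.s≤s ℕ.z≤n , trans (walk-d₀ n) (cong₂ (λ x y → (x , Fin.zero) , (y , Fin.zero)) layer-n (cong rot-r layer-n)) ,
      λ q 0<q q<n eq → ℕ.<⇒≢ 0<q (sym (layer-injective q<n (ℕ.s≤s ℕ.z≤n) (cong proj₁ (trans (sym (walk-d₀ q)) eq))))

    faceVerticesDistinct-d₀ : FaceVerticesDistinct d₀ n
    faceVerticesDistinct-d₀ a b a<b b<n eq =
      ℕ.<⇒≢ a<b (layer-injective (ℕ.<-trans a<b b<n) b<n (trans (cong proj₁ (sym (walk-d₀ a))) (trans eq (cong proj₁ (walk-d₀ b)))))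

    ¬SameFace-rev-d₀ : ¬ SameFace ρ d₀ (rev d₀)
    ¬SameFace-rev-d₀ (K , eq) = ℕ.1+n≢0 (nat-mod-injective 2<n (ℕ.s≤s ℕ.z≤n) 2≡0)
      where
        walk-K = trans (sym (walk-d₀ K)) eq
        K≡1 : + K ≡ + 1 mod n
        K≡1 = iter-rot-r-injective (cong (λ d → proj₁ (proj₁ d)) walk-K)
        K+1≡0 : + suc K ≡ + 0 mod n
        K+1≡0 = iter-rot-r-injective (cong (λ d → proj₁ (proj₂ d)) walk-K)
        2≡0 : + 2 ≡ + 0 mod n
        2≡0 = mod-trans (+-mod-congˡ (+ 1) (mod-sym K≡1)) K+1≡0

    reflection-d₀ : SameFace ρ d₀ (rev (mapD ρ σ d₀))
    reflection-d₀ = n' , trans (walk-d₀ n') (cong₂ (λ x y → (x , Fin.zero) , (y , Fin.zero)) last (trans layer-n (sym negF-zero)))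
      where
        open mod-Reasoning n
        identity : ∀ x → x ≡ - + 1 + + 1 * (+ 1 + x)
        identity = solve-∀
        last : iter rot-r n' Fin.zero ≡ negF (rot-r Fin.zero)
        last = toℤ-injective (begin
          toℤ (iter rot-r n' Fin.zero)   ≈⟨ toℤ-iter-rot-r n' Fin.zero ⟩
          + n'                           ≡⟨ identity (+ n') ⟩
          - + 1 + + 1 * + n              ≈⟨ +-multiple-mod (- + 1) (+ 1) ⟩
          - + 1                          ≈⟨ neg-mod-cong (toℤ-rot-r Fin.zero) ⟨
          - toℤ (rot-r Fin.zero)         ≈⟨ toℤ-negF (rot-r Fin.zero) ⟨
          toℤ (negF (rot-r Fin.zero))    ∎)

    open TransitiveSubgroup InH InH⊆Aut⁺ H-id InH-⨾ H-ext (H-η₁ (H-η₂ H-id)) swap-u₀ swap-v₀ (H-η₂ H-id) η₂-u₀ ρ-u₀-η₂-v₀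

    regular-map : ∃ λ ρ → IsRotationSystem ρ × Polytopal ρ × OfType ρ n (2 ℕ.* m) × Reflexible ρ × RotGroupIs ρ InH
    regular-map =
      ρ , ρ-isRotationSystem ,
      polytopal faceLength-d₀ 2<n faceVerticesDistinct-d₀ ¬SameFace-rev-d₀ ,
      (faceLength faceLength-d₀ , degree≡2m 2<n) ,
      (rotary faceLength-d₀ (H-η₁ H-id) η₁-shifts-d₀ , d₀ , u₀~v₀ , σ , σ-orientRev , reflection-d₀) ,
      rotGroupIs

open import Data.Nat using (ℕ; suc; _+_; _*_; _≤_)
import Data.Nat.Properties as ℕ
open import Data.Nat.Divisibility using (_∣_; *-monoˡ-∣)
open import Data.Product using (∃; _×_)
open import Relation.Nullary using (¬_)

-- The construction only needs 2m ∣ n.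
proposition5p7 : (m s : ℕ) → 3 ≤ m → ¬ (2 ∣ m) → 2 ≤ s → 2 ∣ s → ¬ (4 ∣ s) →
    let n = s * m
        open Lex n m
    in ∃ λ ρ → IsRotationSystem ρ × Polytopal ρ × OfType ρ n (2 * m) ×
               Reflexible ρ × RotGroupIs ρ InH
proposition5p7 (suc m') (suc s') 3≤m _ _ 2∣s _ =
  Construction.regular-map (m' + s' * suc m') m' (ℕ.≤-trans 3≤m (ℕ.m≤n*m (suc m') (suc s'))) (*-monoˡ-∣ (suc m') 2∣s)
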